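{- Let $D$ be a discriminant form of level a power of $2$. Choose a Jordan decomposition $D=A\oplus B$, where $A$ is the sum over the components of type $2_{I\!I}^{\pm n}$, $2_t^{\pm n}$ and $4_s^{\pm m}$ and $B$ the sum over the remaining components. Then $D$ contains no isotropic subgroup isomorphic to $(\mathbb Z/2\mathbb Z)^3$ if and only if $B$ has rank $r$ with $0\le r<3$ and $A\in\mathcal D_{3-r}'$, where $\mathcal D_1'$ consists of $\{0\}$, $2_{I\!I}^{ -2}$, $2_t^{\pm1}$, $2_t^{\pm2}$ with $t\equiv2\bmod4$, $2_t^{\epsilon3}$ with $\epsilon\left(\frac{t}{2}\right)=-1$, $4_t^{\pm1}$, $2_t^{\pm1}4_s^{\pm1}$; $\mathcal D_2'$ consists of $\{0\}$, $2_{I\!I}^{\pm2}$, $2_{I\!I}^{ -4}$, $2_t^{\pm n}$ ($n\le3$), $2_t^{\epsilon4}$ with $\epsilon e(t/8)\ne1$, $2_t^{\epsilon5}$ with $\epsilon\left(\frac{t}{2}\right)=-1$, $4_s^{\pm1}$, $2_{I\!I}^{\pm2}4_s^{\pm1}$, $2_t^{\pm n}4_s^{\pm1}$ ($n\le3$), $4_s^{\pm2}$, $2_t^{\pm1}4_s^{\pm2}$; $\mathcal D_3'$ consists of $\{0\}$, $2_{I\!I}^{\pm2}$, $2_{I\!I}^{\pm4}$, $2_{I\!I}^{ -6}$, $2_t^{\pm n}$ ($n\le5$), $2_t^{\epsilon6}$ with $\epsilon e(t/8)\ne1$, $2_t^{\epsilon7}$ with $\epsilon\left(\frac{t}{2}\right)=-1$,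 $4_s^{\pm1}$, $2_{I\!I}^{\pm2}4_s^{\pm1}$, $2_{I\!I}^{\pm4}4_s^{\pm1}$, $2_t^{\pm n}4_s^{\pm1}$ ($n\le5$), $4_s^{\pm2}$, $2_{I\!I}^{\pm2}4_s^{\pm2}$, $2_t^{\pm n}4_s^{\pm2}$ ($n\le3$), $4_s^{\pm3}$, $2_t^{\pm1}4_s^{\pm3}$.
   Context: A discriminant form is a finite abelian group $D$ with a quadratic form $\operatorname{q}:D\to\mathbb Q/\mathbb Z$ whose bilinear form is non-degenerate; a subgroup is isotropic if $\operatorname{q}$ vanishes on it. Rank means minimal number of generators. 2-adic Jordan components in Conway–Sloane notation: $q_{I\!I}^{\pm2n}$ is an even component isomorphic to $(\mathbb Z/q\mathbb Z)^{2n}$ of level $q$; $q_t^{\pm n}$ is an odd component isomorphic to $(\mathbb Z/q\mathbb Z)^n$ of level $2q$, with oddity $t\in\mathbb Z/8\mathbb Z$. $\left(\frac{t}{2}\right)$ is the Kronecker symbol and $e(z)=e^{2\pi iz}$. -}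

module Defs where

open import Data.Nat as ℕ using (ℕ; zero; suc; _≤_; _<_; _%_)
open import Data.Nat.Properties using (m^n≢0)
open import Data.Integer as ℤ using (ℤ; +_; _◃_)
open import Data.Integer.Divisibility using () renaming (_∣_ to _∣ℤ_)
open import Data.Rational as ℚ using (ℚ)
open import Data.Bool using (Bool; true; false; if_then_else_)
open import Data.Sign as Sign using (Sign)
open import Data.List using (List; []; _∷_; length; concatMap; map; filter)
open import Data.List.Relation.Unary.Linked using (Linked)
open import Data.Fin using (Fin)
open import Data.Unit using (⊤; tt)
open import Data.Empty using (⊥)
open import Data.Product using (_×_; _,_; ∃-syntax; Σ-syntax)
open import Relation.Nullary using (¬_)
open import Relation.Binary.PropositionalEquality using (_≡_)
open import Relation.Nullary.Decidable using (does)

-- A component has scale q = 2 ^ (suc j)  (so q ≥ 2).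
--  * odd component  oddC j (m₁ ∷ … ∷ mₙ):  the orthogonal sum of the
--    cyclic forms  ℤ/qℤ  with  q(x) = uᵢ x² / (2q),  uᵢ = 2 mᵢ + 1  odd.
--    Its Conway–Sloane symbol is  q_t^{ε n}  with  n the length,
--    t = Σ uᵢ mod 8 and ε = Π (2/uᵢ)  (Kronecker symbol).
--  * even component evenC j (b₁ ∷ … ∷ bₖ): orthogonal sum of the
--    2-dimensional forms on (ℤ/qℤ)²
--       U :  q(x,y) = x y / q,     V :  q(x,y) = (x² + x y + y²) / q ,
--    with symbol q_{II}^{ε 2k},  ε = (-1)^{#V}.
-- Every 2-adic Jordan component is isometric to one of these.

data EBlock : Set where
  U V : EBlock

data Comp : Set where
  oddC  : ℕ → List ℕ → Comp
  evenC : ℕ → List EBlock → Comp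

scaleExp : Comp → ℕ
scaleExp (oddC j _)  = j
scaleExp (evenC j _) = j

IsJordan : List Comp → Set
IsJordan = Linked (λ c d → scaleExp c < scaleExp d)

data Block : Set where
  cyc  : ℕ → Block      -- ⟨(2m+1) / 2q⟩
  blkU : Block
  blkV : Block

record Atom : Set where
  constructor atom
  field
    sc  : ℕ
    blk : Block

compAtoms : Comp → List Atom
compAtoms (oddC j ms)  = map (λ m → atom j (cyc m)) ms
compAtoms (evenC j bs) = map (λ { U → atom j blkU ; V → atom j blkV }) bs

atoms : List Comp → List Atom
atoms = concatMap compAtoms

BElem : Block → Set
BElem (cyc _) = ℤ
BElem blkU    = ℤ × ℤ
BElem blkV    = ℤ × ℤ

AElem : List Atom → Set
AElem []       = ⊤
AElem (a ∷ as) = BElem (Atom.blk a) × AElem as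

-- elements of the discriminant form described by a list of components,
-- represented by integer coordinates (taken modulo the scale)
Elem : List Comp → Set
Elem D = AElem (atoms D)

pow2 : ℕ → ℕ
pow2 k = 2 ℕ.^ k

frac : ℤ → ℕ → ℚ
frac z k = ℚ._/_ z (pow2 k) {{m^n≢0 2 k}}

addB : (b : Block) → BElem b → BElem b → BElem b
addB (cyc _) x y = x ℤ.+ y
addB blkU (x , y) (x' , y') = (x ℤ.+ x') , (y ℤ.+ y')
addB blkV (x , y) (x' , y') = (x ℤ.+ x') , (y ℤ.+ y')

smulB : (b : Block) → ℤ → BElem b → BElem b
smulB (cyc _) c x = c ℤ.* x
smulB blkU c (x , y) = (c ℤ.* x) , (c ℤ.* y)
smulB blkV c (x , y) = (c ℤ.* x) , (c ℤ.* y)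

zeroB : (b : Block) → BElem b
zeroB (cyc _) = + 0
zeroB blkU = (+ 0 , + 0)
zeroB blkV = (+ 0 , + 0)

EqB : (j : ℕ) (b : Block) → BElem b → BElem b → Set
EqB j (cyc _) x y = (+ pow2 (suc j)) ∣ℤ (x ℤ.- y)
EqB j blkU (x , y) (x' , y') = ((+ pow2 (suc j)) ∣ℤ (x ℤ.- x')) × ((+ pow2 (suc j)) ∣ℤ (y ℤ.- y'))
EqB j blkV (x , y) (x' , y') = ((+ pow2 (suc j)) ∣ℤ (x ℤ.- x')) × ((+ pow2 (suc j)) ∣ℤ (y ℤ.- y'))

-- quadratic form value (a rational number representing an element of ℚ/ℤ)
qB : (j : ℕ) (b : Block) → BElem b → ℚ
qB j (cyc m) x = frac ((+ (suc (2 ℕ.* m))) ℤ.* x ℤ.* x) (suc (suc j))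
qB j blkU (x , y) = frac (x ℤ.* y) (suc j)
qB j blkV (x , y) = frac (x ℤ.* x ℤ.+ x ℤ.* y ℤ.+ y ℤ.* y) (suc j)

addA : (as : List Atom) → AElem as → AElem as → AElem as
addA [] _ _ = tt
addA (atom j b ∷ as) (x , xs) (y , ys) = addB b x y , addA as xs ys

smulA : (as : List Atom) → ℤ → AElem as → AElem as
smulA [] _ _ = tt
smulA (atom j b ∷ as) c (x , xs) = smulB b c x , smulA as c xs

zeroA : (as : List Atom) → AElem as
zeroA [] = tt
zeroA (atom j b ∷ as) = zeroB b , zeroA as

EqA : (as : List Atom) → AElem as → AElem as → Set
EqA [] _ _ = ⊤
EqA (atom j b ∷ as) (x , xs) (y , ys) = EqB j b x y × EqA as xs ys

qA : (as : List Atom) → AElem as → ℚ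
qA [] _ = ℚ.0ℚ
qA (atom j b ∷ as) (x , xs) = qB j b x ℚ.+ qA as xs

addE : (D : List Comp) → Elem D → Elem D → Elem D
addE D = addA (atoms D)

smulE : (D : List Comp) → ℤ → Elem D → Elem D
smulE D = smulA (atoms D)

0E : (D : List Comp) → Elem D
0E D = zeroA (atoms D)

EqE : (D : List Comp) → Elem D → Elem D → Set
EqE D = EqA (atoms D)

qform : (D : List Comp) → Elem D → ℚ
qform D = qA (atoms D)

IsInt : ℚ → Set
IsInt r = ∃[ z ] r ≡ ℚ._/_ z 1

-- Isotropic subgroups isomorphic to (ℤ/2ℤ)³: the image of an injective
-- homomorphism (ℤ/2ℤ)³ → D on which q vanishes.  Such a homomorphism is
-- given by the images x₁,x₂,x₃ of the standard basis (each killed by 2).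

bit : Bool → ℤ
bit true  = + 1
bit false = + 0

comb3 : (D : List Comp) → Elem D → Elem D → Elem D → Bool → Bool → Bool → Elem D
comb3 D x y z a b c = addE D (addE D (smulE D (bit a) x) (smulE D (bit b) y)) (smulE D (bit c) z)

HasIsotropicZ2³ : List Comp → Set
HasIsotropicZ2³ D =
  Σ[ x ∈ Elem D ] Σ[ y ∈ Elem D ] Σ[ z ∈ Elem D ]
    EqE D (smulE D (+ 2) x) (0E D) × EqE D (smulE D (+ 2) y) (0E D) × EqE D (smulE D (+ 2) z) (0E D) ×
    (∀ a b c → ¬ (a ≡ false × b ≡ false × c ≡ false) → ¬ EqE D (comb3 D x y z a b c) (0E D)) ×
    (∀ a b c → IsInt (qform D (comb3 D x y z a b c)))

lincomb : (D : List Comp) (r : ℕ) → (Fin r → ℤ) → (Fin r → Elem D) → Elem D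
lincomb D zero    c g = 0E D
lincomb D (suc r) c g = addE D (smulE D (c Fin.zero) (g Fin.zero))
                          (lincomb D r (λ i → c (Fin.suc i)) (λ i → g (Fin.suc i)))
  where import Data.Fin as Fin

Generates : (D : List Comp) (r : ℕ) → (Fin r → Elem D) → Set
Generates D r g = ∀ (y : Elem D) → ∃[ c ] EqE D y (lincomb D r c g)

HasRank : List Comp → ℕ → Set
HasRank D r = (∃[ g ] Generates D r g) × (∀ r' → r' < r → ¬ (∃[ g ] Generates D r' g))

-- The splitting D = A ⊕ B.
-- A: components of type 2_{II}^{±n}, 2_t^{±n} (scale 2) and 4_s^{±m} (odd, scale 4).

inA : Comp → Bool
inA (oddC zero _)        = true
inA (oddC (suc zero) _)  = true
inA (oddC (suc (suc _)) _) = false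
inA (evenC zero _)       = true
inA (evenC (suc _) _)    = false

notB : Bool → Bool
notB true = false
notB false = true

compsA compsB : List Comp → List Comp
compsA [] = []
compsA (c ∷ cs) = if inA c then c ∷ compsA cs else compsA cs
compsB [] = []
compsB (c ∷ cs) = if inA c then compsB cs else c ∷ compsB cs

kron2u : ℕ → Sign
kron2u u with u % 8
... | 1 = Sign.+
... | 7 = Sign.+
... | _ = Sign.-

kron2 : ℕ → ℤ
kron2 t with t % 8
... | 1 = + 1
... | 7 = + 1
... | 3 = ℤ.-[1+ 0 ]
... | 5 = ℤ.-[1+ 0 ]
... | _ = + 0

oddSign : List ℕ → Sign
oddSign [] = Sign.+
oddSign (m ∷ ms) = kron2u (suc (2 ℕ.* m)) Sign.* oddSign ms

oddity : List ℕ → ℕ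
oddity ms = sumU ms % 8
  where
  sumU : List ℕ → ℕ
  sumU [] = 0
  sumU (m ∷ ms) = suc (2 ℕ.* m) ℕ.+ sumU ms

evenSign : List EBlock → Sign
evenSign [] = Sign.+
evenSign (U ∷ bs) = evenSign bs
evenSign (V ∷ bs) = Sign.- Sign.* evenSign bs

-- symbol of the scale-2 part of A:  absent,  2_{II}^{ε n},  or  2_t^{ε n}
data Part2 : Set where
  none2 : Part2
  even2 : Sign → ℕ → Part2          -- ε, n
  odd2  : Sign → ℕ → ℕ → Part2      -- ε, n, t

-- symbol of the scale-4 part of A:  absent or 4_s^{ε m}
data Part4 : Set where
  none4 : Part4
  odd4  : Sign → ℕ → ℕ → Part4      -- ε, m, s

part2 : List Comp → Part2
part2 [] = none2
part2 (oddC zero [] ∷ cs) = none2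
part2 (oddC zero ms@(_ ∷ _) ∷ cs) = odd2 (oddSign ms) (length ms) (oddity ms)
part2 (evenC zero [] ∷ cs) = none2
part2 (evenC zero bs@(_ ∷ _) ∷ cs) = even2 (evenSign bs) (2 ℕ.* length bs)
part2 (_ ∷ cs) = part2 cs

part4 : List Comp → Part4
part4 [] = none4
part4 (oddC (suc zero) [] ∷ cs) = none4
part4 (oddC (suc zero) ms@(_ ∷ _) ∷ cs) = odd4 (oddSign ms) (length ms) (oddity ms)
part4 (_ ∷ cs) = part4 cs

-- ε e(t/8) = 1, encoding the 8-th roots of unity e(k/8) by k ∈ ℤ/8ℤ
-- (ε = -1 = e(4/8))
εe8≡1 : Sign → ℕ → Set
εe8≡1 Sign.+ t = t % 8 ≡ 0
εe8≡1 Sign.- t = (t ℕ.+ 4) % 8 ≡ 0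

εkron≡-1 : Sign → ℕ → Set
εkron≡-1 ε t = (ε ◃ 1) ℤ.* kron2 t ≡ ℤ.-[1+ 0 ]

data D'₁ : Part2 → Part4 → Set where
  z      : D'₁ none2 none4
  IIm2   : D'₁ (even2 Sign.- 2) none4
  o1     : ∀ {ε t} → D'₁ (odd2 ε 1 t) none4
  o2     : ∀ {ε t} → t % 4 ≡ 2 → D'₁ (odd2 ε 2 t) none4
  o3     : ∀ {ε t} → εkron≡-1 ε t → D'₁ (odd2 ε 3 t) none4
  f1     : ∀ {ε s} → D'₁ none2 (odd4 ε 1 s)
  o1f1   : ∀ {ε t δ s} → D'₁ (odd2 ε 1 t) (odd4 δ 1 s)

data D'₂ : Part2 → Part4 → Set where
  z      : D'₂ none2 none4
  II2    : ∀ {ε} → D'₂ (even2 ε 2) none4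
  IIm4   : D'₂ (even2 Sign.- 4) none4
  on     : ∀ {ε n t} → 1 ≤ n → n ≤ 3 → D'₂ (odd2 ε n t) none4
  o4     : ∀ {ε t} → ¬ εe8≡1 ε t → D'₂ (odd2 ε 4 t) none4
  o5     : ∀ {ε t} → εkron≡-1 ε t → D'₂ (odd2 ε 5 t) none4
  f1     : ∀ {ε s} → D'₂ none2 (odd4 ε 1 s)
  II2f1  : ∀ {ε δ s} → D'₂ (even2 ε 2) (odd4 δ 1 s)
  onf1   : ∀ {ε n t δ s} → 1 ≤ n → n ≤ 3 → D'₂ (odd2 ε n t) (odd4 δ 1 s)
  f2     : ∀ {ε s} → D'₂ none2 (odd4 ε 2 s)
  o1f2   : ∀ {ε t δ s} → D'₂ (odd2 ε 1 t) (odd4 δ 2 s)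

data D'₃ : Part2 → Part4 → Set where
  z      : D'₃ none2 none4
  II2    : ∀ {ε} → D'₃ (even2 ε 2) none4
  II4    : ∀ {ε} → D'₃ (even2 ε 4) none4
  IIm6   : D'₃ (even2 Sign.- 6) none4
  on     : ∀ {ε n t} → 1 ≤ n → n ≤ 5 → D'₃ (odd2 ε n t) none4
  o6     : ∀ {ε t} → ¬ εe8≡1 ε t → D'₃ (odd2 ε 6 t) none4
  o7     : ∀ {ε t} → εkron≡-1 ε t → D'₃ (odd2 ε 7 t) none4
  f1     : ∀ {ε s} → D'₃ none2 (odd4 ε 1 s)
  II2f1  : ∀ {ε δ s} → D'₃ (even2 ε 2) (odd4 δ 1 s)
  II4f1  : ∀ {ε δ s} → D'₃ (even2 ε 4) (odd4 δ 1 s)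
  onf1   : ∀ {ε n t δ s} → 1 ≤ n → n ≤ 5 → D'₃ (odd2 ε n t) (odd4 δ 1 s)
  f2     : ∀ {ε s} → D'₃ none2 (odd4 ε 2 s)
  II2f2  : ∀ {ε δ s} → D'₃ (even2 ε 2) (odd4 δ 2 s)
  onf2   : ∀ {ε n t δ s} → 1 ≤ n → n ≤ 3 → D'₃ (odd2 ε n t) (odd4 δ 2 s)
  f3     : ∀ {ε s} → D'₃ none2 (odd4 ε 3 s)
  o1f3   : ∀ {ε t δ s} → D'₃ (odd2 ε 1 t) (odd4 δ 3 s)

D' : ℕ → Part2 → Part4 → Set
D' 1 = D'₁
D' 2 = D'₂
D' 3 = D'₃
D' _ = λ _ _ → ⊥

InD' : ℕ → List Comp → Set
InD' k A = D' k (part2 A) (part4 A)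

-- An isotropic (ℤ/2)³ lies in the 2-torsion D[2]. An element of order 2 of a component of
-- scale 2^(j+1) is 2^j·k, and q on it depends only on k mod 2, with values in ¼ℤ/ℤ. So D[2]
-- is an 𝔽₂-space with a ℤ/4-valued form, the orthogonal sum of one cell per cyclic or
-- two-dimensional summand: an odd summand ⟨u/2q⟩ gives a line with 4q = u mod 4 (scale 2),
-- 2 (scale 4) or 0 (scale ≥ 8), and an even summand gives U, V (scale 2) or a null plane.
-- Hence B contributes exactly rank B null lines, three of which already span an isotropic
-- (ℤ/2)³, while A contributes a configuration of cells determined by the ranks of its two
-- parts, the invariant ε e(t/8) and the sign of an even part. Isotropic subgroups of a
-- sublist of cells survive in the whole list, so beyond the sizes occurring in 𝒟'_k they
-- always exist, and the finitely many remaining configurations are decided by search.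

module Submission where


module Cells where

  open import Defs using (EBlock; U; V)
  open import Data.Bool using (Bool; true; false; _∧_; _∨_; _xor_; if_then_else_; T)
  open import Data.Bool.Properties using (∨-assoc; xor-identityʳ; T-∧)
  open import Data.Nat using (ℕ; zero; _+_; _%_; _≡ᵇ_)
  open import Data.Nat.Properties using (+-commutativeSemigroup)
  open import Algebra.Properties.CommutativeSemigroup +-commutativeSemigroup using (x∙yz≈y∙xz)
  open import Data.List using (List; []; _∷_; _++_; replicate)
  open import Data.List.Relation.Binary.Permutation.Propositional as Perm using (_↭_)
  open import Data.List.Relation.Binary.Sublist.Propositional using (_⊆_; []; _∷_; _∷ʳ_)
  open import Data.Product using (_×_; _,_; Σ-syntax; proj₁; proj₂)
  open import Data.Unit using (⊤; tt)
  open import Data.Maybe using (Maybe; just; nothing)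
  open import Data.List.Relation.Unary.All using (All; []; _∷_)
  open import Data.Empty using (⊥-elim)
  open import Function using (_∘_)
  open import Function.Bundles using (Equivalence)
  open import Relation.Nullary using (¬_)
  open import Relation.Binary.PropositionalEquality using (_≡_; refl; sym; trans; cong; cong₂; subst)

  -- A line whose generator has 4q = k, or the plane U (4q = 2xy), V (4q = 2(x² + xy + y²))
  -- or a plane on which q vanishes (nothing); 4q is read in ℤ/4.
  data Cell : Set where
    line  : ℕ → Cell
    plane : Maybe EBlock → Cell

  Coords : Cell → Set
  Coords (line _)  = Bool
  Coords (plane _) = Bool × Bool

  Vect : List Cell → Set
  Vect []       = ⊤
  Vect (c ∷ cs) = Coords c × Vect cs

  addᶜ : (c : Cell) → Coords c → Coords c → Coords c
  addᶜ (line _)  a b = a xor b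
  addᶜ (plane _) (a , a') (b , b') = a xor b , a' xor b'

  zeroᶜ : (c : Cell) → Coords c
  zeroᶜ (line _)  = false
  zeroᶜ (plane _) = false , false

  nonzeroᶜ : (c : Cell) → Coords c → Bool
  nonzeroᶜ (line _)  a        = a
  nonzeroᶜ (plane _) (a , a') = a ∨ a'

  formᶜ : (c : Cell) → Coords c → ℕ
  formᶜ (line k)         a        = if a then k else 0
  formᶜ (plane (just U)) (a , a') = if a ∧ a' then 2 else 0
  formᶜ (plane (just V)) (a , a') = if a ∨ a' then 2 else 0
  formᶜ (plane nothing)  _        = 0

  add : (cs : List Cell) → Vect cs → Vect cs → Vect cs
  add []       _        _        = tt
  add (c ∷ cs) (a , xs) (b , ys) = addᶜ c a b , add cs xs ys

  zeroV : (cs : List Cell) → Vect cs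
  zeroV []       = tt
  zeroV (c ∷ cs) = zeroᶜ c , zeroV cs

  nonzero : (cs : List Cell) → Vect cs → Bool
  nonzero []       _        = false
  nonzero (c ∷ cs) (a , xs) = nonzeroᶜ c a ∨ nonzero cs xs

  form : (cs : List Cell) → Vect cs → ℕ
  form []       _        = 0
  form (c ∷ cs) (a , xs) = formᶜ c a + form cs xs

  isotropic : (cs : List Cell) → Vect cs → Bool
  isotropic cs x = nonzero cs x ∧ (form cs x % 4 ≡ᵇ 0)

  -- x, y, z span an isotropic (ℤ/2)³ iff each of their seven nonzero
  -- combinations is nonzero and isotropic; the conditions are grouped by the
  -- last vector they involve, so that a search can prune on them.
  extends₂ : (cs : List Cell) → Vect cs → Vect cs → Bool
  extends₂ cs x y = isotropic cs y ∧ isotropic cs (add cs x y)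

  extends₃ : (cs : List Cell) → Vect cs → Vect cs → Vect cs → Bool
  extends₃ cs x y z =
    isotropic cs z ∧ isotropic cs (add cs x z) ∧ isotropic cs (add cs y z) ∧ isotropic cs (add cs (add cs x y) z)

  isotropicTriple : (cs : List Cell) → Vect cs → Vect cs → Vect cs → Bool
  isotropicTriple cs x y z = isotropic cs x ∧ extends₂ cs x y ∧ extends₃ cs x y z

  HasIsotropic3 : List Cell → Set
  HasIsotropic3 cs = Σ[ x ∈ Vect cs ] Σ[ y ∈ Vect cs ] Σ[ z ∈ Vect cs ] T (isotropicTriple cs x y z)

  record Isometry (cs cs' : List Cell) : Set where
    field
      to         : Vect cs → Vect cs'
      to-add     : ∀ x y → to (add cs x y) ≡ add cs' (to x) (to y)
      nonzero-to : ∀ x → nonzero cs' (to x) ≡ nonzero cs x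
      form-to    : ∀ x → form cs' (to x) ≡ form cs x

    isotropic-to : ∀ x → isotropic cs' (to x) ≡ isotropic cs x
    isotropic-to x = cong₂ (λ a b → a ∧ (b % 4 ≡ᵇ 0)) (nonzero-to x) (form-to x)

    isotropic-to-add : ∀ x y → isotropic cs' (add cs' (to x) (to y)) ≡ isotropic cs (add cs x y)
    isotropic-to-add x y = trans (cong (isotropic cs') (sym (to-add x y))) (isotropic-to (add cs x y))

    isotropicTriple-to : ∀ x y z → isotropicTriple cs' (to x) (to y) (to z) ≡ isotropicTriple cs x y z
    isotropicTriple-to x y z =
      cong₂ _∧_ (isotropic-to x) (cong₂ _∧_ (cong₂ _∧_ (isotropic-to y) (isotropic-to-add x y))
        (cong₂ _∧_ (isotropic-to z) (cong₂ _∧_ (isotropic-to-add x z) (cong₂ _∧_ (isotropic-to-add y z)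
          (trans (cong (λ w → isotropic cs' (add cs' w (to z))) (sym (to-add x y)))
                 (isotropic-to-add (add cs x y) z))))))

    transport : HasIsotropic3 cs → HasIsotropic3 cs'
    transport (x , y , z , t) = to x , to y , to z , subst T (sym (isotropicTriple-to x y z)) t

  open Isometry public using (transport)

  idᴵ : ∀ {cs} → Isometry cs cs
  idᴵ = record { to = λ x → x ; to-add = λ _ _ → refl ; nonzero-to = λ _ → refl ; form-to = λ _ → refl }

  infixr 9 _∘ᴵ_
  _∘ᴵ_ : ∀ {cs cs' cs''} → Isometry cs' cs'' → Isometry cs cs' → Isometry cs cs''
  G ∘ᴵ F = record
    { to         = λ x → G.to (F.to x)
    ; to-add     = λ x y → trans (cong G.to (F.to-add x y)) (G.to-add _ _)
    ; nonzero-to = λ x → trans (G.nonzero-to _) (F.nonzero-to x)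
    ; form-to    = λ x → trans (G.form-to _) (F.form-to x) }
    where module F = Isometry F
          module G = Isometry G

  infixr 5 _∷ᴵ_
  _∷ᴵ_ : ∀ {cs cs'} (c : Cell) → Isometry cs cs' → Isometry (c ∷ cs) (c ∷ cs')
  c ∷ᴵ F = record
    { to         = λ { (a , x) → a , F.to x }
    ; to-add     = λ { (a , x) (b , y) → cong (addᶜ c a b ,_) (F.to-add x y) }
    ; nonzero-to = λ { (a , x) → cong (nonzeroᶜ c a ∨_) (F.nonzero-to x) }
    ; form-to    = λ { (a , x) → cong (formᶜ c a +_) (F.form-to x) } }
    where module F = Isometry F

  ++ᴵ : ∀ {cs cs'} (ds : List Cell) → Isometry cs cs' → Isometry (ds ++ cs) (ds ++ cs')
  ++ᴵ []       F = F
  ++ᴵ (d ∷ ds) F = d ∷ᴵ ++ᴵ ds F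

  swapᴵ : ∀ {cs} (c d : Cell) → Isometry (c ∷ d ∷ cs) (d ∷ c ∷ cs)
  swapᴵ c d = record
    { to         = λ { (a , b , x) → b , a , x }
    ; to-add     = λ _ _ → refl
    ; nonzero-to = λ { (a , b , x) → ∨-swap (nonzeroᶜ d b) (nonzeroᶜ c a) _ }
    ; form-to    = λ { (a , b , x) → x∙yz≈y∙xz (formᶜ d b) (formᶜ c a) _ } }
    where
    ∨-swap : ∀ a b c → a ∨ (b ∨ c) ≡ b ∨ (a ∨ c)
    ∨-swap true  true  c = refl
    ∨-swap true  false c = refl
    ∨-swap false b     c = refl

  ↭ᴵ : ∀ {cs cs'} → cs ↭ cs' → Isometry cs cs'
  ↭ᴵ Perm.refl          = idᴵ
  ↭ᴵ (Perm.prep c π)    = c ∷ᴵ ↭ᴵ π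
  ↭ᴵ (Perm.swap c d π)  = (d ∷ᴵ c ∷ᴵ ↭ᴵ π) ∘ᴵ swapᴵ c d
  ↭ᴵ (Perm.trans π ρ)   = ↭ᴵ ρ ∘ᴵ ↭ᴵ π

  -- A sublist is an isometric subspace: pad the missing cells with zero.
  ⊆ᴵ : ∀ {cs cs'} → cs ⊆ cs' → Isometry cs cs'
  ⊆ᴵ []           = idᴵ
  ⊆ᴵ (refl ∷ σ)   = _ ∷ᴵ ⊆ᴵ σ
  ⊆ᴵ (_∷ʳ_ c σ) = record
    { to         = λ x → zeroᶜ c , F.to x
    ; to-add     = λ x y → cong₂ _,_ (sym (addᶜ-zero c)) (F.to-add x y)
    ; nonzero-to = λ x → trans (cong (_∨ _) (nonzeroᶜ-zero c)) (F.nonzero-to x)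
    ; form-to    = λ x → trans (cong (_+ _) (formᶜ-zero c)) (F.form-to x) }
    where
    module F = Isometry (⊆ᴵ σ)
    addᶜ-zero : ∀ c → addᶜ c (zeroᶜ c) (zeroᶜ c) ≡ zeroᶜ c
    addᶜ-zero (line _)  = refl
    addᶜ-zero (plane _) = refl
    nonzeroᶜ-zero : ∀ c → nonzeroᶜ c (zeroᶜ c) ≡ false
    nonzeroᶜ-zero (line _)  = refl
    nonzeroᶜ-zero (plane _) = refl
    formᶜ-zero : ∀ c → formᶜ c (zeroᶜ c) ≡ 0
    formᶜ-zero (line _)  = refl
    formᶜ-zero (plane (just U)) = refl
    formᶜ-zero (plane (just V)) = refl
    formᶜ-zero (plane nothing)  = refl

  dimᶜ : Cell → ℕ
  dimᶜ (line _)  = 1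
  dimᶜ (plane _) = 2

  dim : List Cell → ℕ
  dim []       = 0
  dim (c ∷ cs) = dimᶜ c + dim cs

  data IsNull : Cell → Set where
    nullLine  : IsNull (line 0)
    nullPlane : IsNull (plane nothing)

  nullLines : ℕ → List Cell
  nullLines n = replicate n (line 0)

  null-if : ∀ a → (if a then 0 else 0) ≡ 0
  null-if true  = refl
  null-if false = refl

  flattenᴵ : ∀ {cs} → All IsNull cs → Isometry cs (nullLines (dim cs))
  flattenᴵ []                = idᴵ
  flattenᴵ (nullLine  ∷ ns) = line 0 ∷ᴵ flattenᴵ ns
  flattenᴵ (nullPlane ∷ ns) = record
    { to         = λ { ((a , b) , x) → a , b , F.to x }
    ; to-add     = λ { ((a , b) , x) ((a' , b') , y) → cong (λ w → a xor a' , b xor b' , w) (F.to-add x y) }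
    ; nonzero-to = λ { ((a , b) , x) → trans (cong (λ w → a ∨ b ∨ w) (F.nonzero-to x)) (sym (∨-assoc a b _)) }
    ; form-to    = λ { ((a , b) , x) → trans (cong₂ _+_ (null-if a) (cong (_+ _) (null-if b))) (F.form-to x) } }
    where module F = Isometry (flattenᴵ ns)

  unflattenᴵ : ∀ {cs} → All IsNull cs → Isometry (nullLines (dim cs)) cs
  unflattenᴵ []                = idᴵ
  unflattenᴵ (nullLine  ∷ ns) = line 0 ∷ᴵ unflattenᴵ ns
  unflattenᴵ (nullPlane ∷ ns) = record
    { to         = λ { (a , b , x) → (a , b) , F.to x }
    ; to-add     = λ { (a , b , x) (a' , b' , y) → cong (λ w → (a xor a' , b xor b') , w) (F.to-add x y) }
    ; nonzero-to = λ { (a , b , x) → trans (∨-assoc a b _) (cong (λ w → a ∨ b ∨ w) (F.nonzero-to x)) }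
    ; form-to    = λ { (a , b , x) → trans (F.form-to x) (sym (cong₂ _+_ (null-if a) (cong (_+ _) (null-if b)))) } }
    where module F = Isometry (unflattenᴵ ns)

  scaleᶜ : (c : Cell) → Bool → Coords c → Coords c
  scaleᶜ (line _)  k a        = k ∧ a
  scaleᶜ (plane _) k (a , a') = k ∧ a , k ∧ a'

  scale : (cs : List Cell) → Bool → Vect cs → Vect cs
  scale []       _ _        = tt
  scale (c ∷ cs) k (a , xs) = scaleᶜ c k a , scale cs k xs

  combination : (cs : List Cell) → Bool → Bool → Bool → Vect cs → Vect cs → Vect cs → Vect cs
  combination cs a b c x y z = add cs (add cs (scale cs a x) (scale cs b y)) (scale cs c z)

  scale-true : ∀ cs x → scale cs true x ≡ x
  scale-true []                 _              = refl
  scale-true (line _  ∷ cs)     (a , xs)       = cong (a ,_) (scale-true cs xs)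
  scale-true (plane _ ∷ cs)     ((a , b) , xs) = cong ((a , b) ,_) (scale-true cs xs)

  scale-false : ∀ cs x → scale cs false x ≡ zeroV cs
  scale-false []               _        = refl
  scale-false (line _  ∷ cs)   (_ , xs) = cong (false ,_) (scale-false cs xs)
  scale-false (plane _ ∷ cs)   (_ , xs) = cong ((false , false) ,_) (scale-false cs xs)

  add-zeroˡ : ∀ cs x → add cs (zeroV cs) x ≡ x
  add-zeroˡ []               _              = refl
  add-zeroˡ (line _  ∷ cs)   (a , xs)       = cong (a ,_) (add-zeroˡ cs xs)
  add-zeroˡ (plane _ ∷ cs)   ((a , b) , xs) = cong ((a , b) ,_) (add-zeroˡ cs xs)

  add-zeroʳ : ∀ cs x → add cs x (zeroV cs) ≡ x
  add-zeroʳ []               _              = refl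
  add-zeroʳ (line _  ∷ cs)   (a , xs)       = cong₂ _,_ (xor-identityʳ a) (add-zeroʳ cs xs)
  add-zeroʳ (plane _ ∷ cs)   ((a , b) , xs) =
    cong₂ _,_ (cong₂ _,_ (xor-identityʳ a) (xor-identityʳ b)) (add-zeroʳ cs xs)

  form-zero : ∀ cs → form cs (zeroV cs) ≡ 0
  form-zero []               = refl
  form-zero (line _  ∷ cs)   = form-zero cs
  form-zero (plane (just U) ∷ cs) = form-zero cs
  form-zero (plane (just V) ∷ cs) = form-zero cs
  form-zero (plane nothing ∷ cs)  = form-zero cs

  NonTrivial : Bool → Bool → Bool → Set
  NonTrivial a b c = ¬ (a ≡ false × b ≡ false × c ≡ false)

  module _ (cs : List Cell) (x y z : Vect cs) where

    private
      comb = combination cs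
      _⊕_ = add cs

    combination-100 : comb true false false x y z ≡ x
    combination-100 rewrite scale-true cs x | scale-false cs y | scale-false cs z | add-zeroʳ cs x = add-zeroʳ cs x

    combination-010 : comb false true false x y z ≡ y
    combination-010 rewrite scale-false cs x | scale-true cs y | scale-false cs z | add-zeroˡ cs y = add-zeroʳ cs y

    combination-110 : comb true true false x y z ≡ x ⊕ y
    combination-110 rewrite scale-true cs x | scale-true cs y | scale-false cs z = add-zeroʳ cs (x ⊕ y)

    combination-001 : comb false false true x y z ≡ z
    combination-001 rewrite scale-false cs x | scale-false cs y | scale-true cs z | add-zeroˡ cs (zeroV cs) = add-zeroˡ cs z

    combination-101 : comb true false true x y z ≡ x ⊕ z
    combination-101 rewrite scale-true cs x | scale-false cs y | scale-true cs z | add-zeroʳ cs x = refl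

    combination-011 : comb false true true x y z ≡ y ⊕ z
    combination-011 rewrite scale-false cs x | scale-true cs y | scale-true cs z | add-zeroˡ cs y = refl

    combination-111 : comb true true true x y z ≡ (x ⊕ y) ⊕ z
    combination-111 rewrite scale-true cs x | scale-true cs y | scale-true cs z = refl

    combination-000 : comb false false false x y z ≡ zeroV cs
    combination-000 rewrite scale-false cs x | scale-false cs y | scale-false cs z | add-zeroʳ cs (zeroV cs) = add-zeroʳ cs (zeroV cs)

    isotropicTriple⇒ : T (isotropicTriple cs x y z) →
                       ∀ a b c → NonTrivial a b c → T (isotropic cs (comb a b c x y z))
    isotropicTriple⇒ t a b c nt = case a b c nt
      where
      split : ∀ p {q} → T (p ∧ q) → T p × T q
      split p = Equivalence.to (T-∧ {p})
      iso = isotropic cs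
      ix   = proj₁ (split (iso x) t)
      r₁   = proj₂ (split (iso x) t)
      iy   = proj₁ (split (iso y) (proj₁ (split (extends₂ cs x y) r₁)))
      ixy  = proj₂ (split (iso y) (proj₁ (split (extends₂ cs x y) r₁)))
      r₂   = proj₂ (split (extends₂ cs x y) r₁)
      iz   = proj₁ (split (iso z) r₂)
      r₃   = proj₂ (split (iso z) r₂)
      ixz  = proj₁ (split (iso (x ⊕ z)) r₃)
      r₄   = proj₂ (split (iso (x ⊕ z)) r₃)
      iyz  = proj₁ (split (iso (y ⊕ z)) r₄)
      ixyz = proj₂ (split (iso (y ⊕ z)) r₄)
      case : ∀ a b c → NonTrivial a b c → T (isotropic cs (comb a b c x y z))
      case true  false false _  = subst (T ∘ isotropic cs) (sym combination-100) ix
      case false true  false _  = subst (T ∘ isotropic cs) (sym combination-010) iy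
      case true  true  false _  = subst (T ∘ isotropic cs) (sym combination-110) ixy
      case false false true  _  = subst (T ∘ isotropic cs) (sym combination-001) iz
      case true  false true  _  = subst (T ∘ isotropic cs) (sym combination-101) ixz
      case false true  true  _  = subst (T ∘ isotropic cs) (sym combination-011) iyz
      case true  true  true  _  = subst (T ∘ isotropic cs) (sym combination-111) ixyz
      case false false false nt = ⊥-elim (nt (refl , refl , refl))

    isotropicTriple⇐ : (∀ a b c → NonTrivial a b c → T (isotropic cs (comb a b c x y z))) →
                       T (isotropicTriple cs x y z)
    isotropicTriple⇐ i =
      i' true false false combination-100 (λ ()) ∧ᵀ
      (i' false true false combination-010 (λ ()) ∧ᵀ i' true true false combination-110 (λ ())) ∧ᵀ
      i' false false true combination-001 (λ ()) ∧ᵀ i' true false true combination-101 (λ ()) ∧ᵀ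
      i' false true true combination-011 (λ ()) ∧ᵀ i' true true true combination-111 (λ ())
      where
      _∧ᵀ_ : ∀ {p q} → T p → T q → T (p ∧ q)
      p ∧ᵀ q = Equivalence.from T-∧ (p , q)
      infixr 6 _∧ᵀ_
      i' : ∀ a b c {w} → comb a b c x y z ≡ w → NonTrivial a b c → T (isotropic cs w)
      i' a b c e nt = subst (T ∘ isotropic cs) e (i a b c nt)


module Search where

  open Cells
  open import Data.Bool using (Bool; true; false; _∧_; _∨_; not; T)
  open import Data.Bool.Properties using (T-∧)
  open import Data.List using (List; []; _∷_; cartesianProduct)
  open import Data.Bool.ListAction using (all)
  open import Data.List.Membership.Propositional using (_∈_)
  open import Data.List.Membership.Propositional.Properties using (∈-cartesianProduct⁺)
  open import Data.List.Relation.Unary.All using (lookup)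
  open import Data.List.Relation.Unary.All.Properties using (all⁺)
  open import Data.List.Relation.Unary.Any using (here; there)
  open import Data.Maybe using (Maybe; just; nothing)
  open import Data.Product using (_×_; _,_; proj₁; proj₂)
  open import Data.Empty using (⊥)
  open import Data.Unit using (tt)
  open import Function.Bundles using (Equivalence)
  open import Relation.Binary.PropositionalEquality using (refl)
  open import Relation.Nullary using (¬_)

  bools : List Bool
  bools = false ∷ true ∷ []

  ∈-bools : ∀ b → b ∈ bools
  ∈-bools false = here refl
  ∈-bools true  = there (here refl)

  coordsᶜ : (c : Cell) → List (Coords c)
  coordsᶜ (line _)  = bools
  coordsᶜ (plane _) = cartesianProduct bools bools

  ∈-coordsᶜ : ∀ c a → a ∈ coordsᶜ c
  ∈-coordsᶜ (line _)  a       = ∈-bools a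
  ∈-coordsᶜ (plane _) (a , b) = ∈-cartesianProduct⁺ (∈-bools a) (∈-bools b)

  vectors : (cs : List Cell) → List (Vect cs)
  vectors []       = tt ∷ []
  vectors (c ∷ cs) = cartesianProduct (coordsᶜ c) (vectors cs)

  ∈-vectors : ∀ cs x → x ∈ vectors cs
  ∈-vectors []       tt       = here refl
  ∈-vectors (c ∷ cs) (a , xs) = ∈-cartesianProduct⁺ (∈-coordsᶜ c a) (∈-vectors cs xs)

  all-∈ : ∀ {A : Set} (p : A → Bool) {xs x} → T (all p xs) → x ∈ xs → T (p x)
  all-∈ p {xs} t = lookup (all⁺ p xs t)

  noIsotropicTriple : List Cell → Bool
  noIsotropicTriple cs =
    all (λ x → not (isotropic cs x) ∨
      all (λ y → not (extends₂ cs x y) ∨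
        all (λ z → not (extends₃ cs x y z)) (vectors cs)) (vectors cs)) (vectors cs)

  noIsotropicTriple-sound : ∀ cs → T (noIsotropicTriple cs) → ¬ HasIsotropic3 cs
  noIsotropicTriple-sound cs t (x , y , z , i) = refute (extends₃ cs x y z) tz i₃
    where
    split : ∀ p {q} → T (p ∧ q) → T p × T q
    split p = Equivalence.to (T-∧ {p})
    implies : ∀ {p q} → T (not p ∨ q) → T p → T q
    implies {true} t _ = t
    refute : ∀ p → T (not p) → T p → ⊥
    refute true ()
    refute false _ ()
    i₁ = split (isotropic cs x) i
    i₂ = split (extends₂ cs x y) (proj₂ i₁)
    i₃ = proj₂ i₂
    tx = implies (all-∈ _ t (∈-vectors cs x)) (proj₁ i₁)
    ty = implies (all-∈ _ tx (∈-vectors cs y)) (proj₁ i₂)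
    tz = all-∈ _ ty (∈-vectors cs z)

  firstJust : ∀ {A B : Set} → (A → Maybe B) → List A → Maybe B
  firstJust f []       = nothing
  firstJust f (x ∷ xs) with f x
  ... | just b  = just b
  ... | nothing = firstJust f xs

  findIsotropicTriple : (cs : List Cell) → Maybe (HasIsotropic3 cs)
  findIsotropicTriple cs =
    firstJust (λ x → when (isotropic cs x) λ ix →
      firstJust (λ y → when (extends₂ cs x y) λ i₂ →
        firstJust (λ z → when (extends₃ cs x y z) λ i₃ →
          just (x , y , z , ∧-intro ix (∧-intro i₂ i₃))) (vectors cs)) (vectors cs)) (vectors cs)
    where
    when : ∀ {C : Set} (b : Bool) → (T b → Maybe C) → Maybe C
    when true  k = k tt
    when false _ = nothing
    ∧-intro : ∀ {p q} → T p → T q → T (p ∧ q)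
    ∧-intro p q = Equivalence.from T-∧ (p , q)


module Tables where

  open import Defs using (EBlock; U; V)
  open Cells
  open Search
  open import Data.Bool using (Bool; true; false; _∧_; _∨_; not; if_then_else_)
  open import Data.Bool.ListAction using (all)
  open import Data.Maybe using (is-just; just)
  open import Data.Nat using (ℕ; zero; suc; _+_; _*_; _∸_; _%_; _≡ᵇ_; _≤ᵇ_)
  open import Data.List using (List; []; _∷_; _++_; map; replicate; length; upTo)

  -- The line ⟨u/4⟩ of an odd summand of scale 2, by u mod 4: true for 1, false for 3.
  residueLine : Bool → Cell
  residueLine b = line (if b then 1 else 3)

  shape : List Cell → ℕ → ℕ → List Cell
  shape scale₂ m N = scale₂ ++ replicate m (line 2) ++ nullLines N

  livePlane : EBlock → Cell
  livePlane e = plane (just e)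

  oddShape : List Bool → ℕ → ℕ → List Cell
  oddShape bs = shape (map residueLine bs)

  evenShape : List EBlock → ℕ → ℕ → List Cell
  evenShape es = shape (map livePlane es)

  count₁ count₃ : List Bool → ℕ
  count₁ []           = 0
  count₁ (true  ∷ bs) = suc (count₁ bs)
  count₁ (false ∷ bs) = count₁ bs
  count₃ []           = 0
  count₃ (true  ∷ bs) = count₃ bs
  count₃ (false ∷ bs) = suc (count₃ bs)

  signedOddityOf : ℕ → ℕ → ℕ
  signedOddityOf a b = (a + 7 * b) % 8

  -- #{uᵢ ≡ 1} − #{uᵢ ≡ 3} mod 8 determines the invariant ε e(t/8) of 2_t^ε (invariant-oddity).
  signedOddity : List Bool → ℕ
  signedOddity bs = signedOddityOf (count₁ bs) (count₃ bs)

  minusSign : List EBlock → Bool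
  minusSign []       = false
  minusSign (U ∷ es) = minusSign es
  minusSign (V ∷ es) = not (minusSign es)

  _==_ : ℕ → ℕ → Bool
  _==_ = _≡ᵇ_

  e∈35 e∈26 : ℕ → Bool
  e∈35 e = (e == 3) ∨ (e == 5)
  e∈26 e = (e == 2) ∨ (e == 6)

  memberᵒ : ℕ → ℕ → ℕ → ℕ → Bool
  memberᵒ 1 n e m = ((m ≤ᵇ 1) ∧ (n ≤ᵇ 1)) ∨ ((m == 0) ∧ (n == 2) ∧ e∈26 e) ∨ ((m == 0) ∧ (n == 3) ∧ e∈35 e)
  memberᵒ 2 n e m =
    ((m ≤ᵇ 1) ∧ (n ≤ᵇ 3)) ∨ ((m == 0) ∧ (n == 4) ∧ not (e == 0)) ∨ ((m == 0) ∧ (n == 5) ∧ e∈35 e) ∨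
    ((n ≤ᵇ 1) ∧ (m == 2))
  memberᵒ 3 n e m =
    ((m ≤ᵇ 1) ∧ (n ≤ᵇ 5)) ∨ ((m == 0) ∧ (n == 6) ∧ not (e == 0)) ∨ ((m == 0) ∧ (n == 7) ∧ e∈35 e) ∨
    ((n ≤ᵇ 3) ∧ (m == 2)) ∨ ((n ≤ᵇ 1) ∧ (m == 3))
  memberᵒ _ _ _ _ = false

  memberᵉ : ℕ → ℕ → Bool → ℕ → Bool
  memberᵉ 1 b v m = (b == 1) ∧ v ∧ (m == 0)
  memberᵉ 2 b v m = ((b == 1) ∧ (m ≤ᵇ 1)) ∨ ((b == 2) ∧ v ∧ (m == 0))
  memberᵉ 3 b v m = ((b == 1) ∧ (m ≤ᵇ 2)) ∨ ((b == 2) ∧ (m ≤ᵇ 1)) ∨ ((b == 3) ∧ v ∧ (m == 0))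
  memberᵉ _ _ _ _ = false

  oddCap : ℕ → ℕ
  oddCap k = suc (2 * k)

  -- Membership of A in 𝒟'_k, its scale-4 part having rank m and its scale-2 part being
  -- absent or odd of rank n with invariant e (inD'ᵒ), or even with b blocks and sign −
  -- iff v (inD'ᵉ). The conjunctions are ordered so that membership reduces as soon as
  -- the relevant ranks are numerals, and the redundant bounds make them recoverable.
  inD'ᵒ : ℕ → ℕ → ℕ → ℕ → Bool
  inD'ᵒ k n e m = (n ≤ᵇ oddCap k) ∧ memberᵒ k n e m ∧ (m ≤ᵇ k)

  inD'ᵉ : ℕ → ℕ → Bool → ℕ → Bool
  inD'ᵉ k b v m = (b ≤ᵇ k) ∧ memberᵉ k b v m ∧ (m ≤ᵇ k)

  boolLists : ℕ → List (List Bool)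
  boolLists zero    = [] ∷ []
  boolLists (suc n) = map (true ∷_) (boolLists n) ++ map (false ∷_) (boolLists n)

  blockLists : ℕ → List (List EBlock)
  blockLists zero    = [] ∷ []
  blockLists (suc n) = map (U ∷_) (blockLists n) ++ map (V ∷_) (blockLists n)

  sorted : ℕ → ℕ → List Bool
  sorted a b = replicate a true ++ replicate b false

  ∀< : ℕ → (ℕ → Bool) → Bool
  ∀< n p = all p (upTo n)

  ∀≤ : ℕ → (ℕ → Bool) → Bool
  ∀≤ n p = all p (upTo (suc n))

  found : List Cell → Bool
  found cs = is-just (findIsotropicTriple cs)

  memberFreeᵒ : ℕ → ℕ → ℕ → ℕ → ℕ → Bool
  memberFreeᵒ k N n m a =
    not (inD'ᵒ k n (signedOddityOf a (n ∸ a)) m) ∨ noIsotropicTriple (oddShape (sorted a (n ∸ a)) m N)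

  memberFreeᵉ : ℕ → ℕ → ℕ → List EBlock → Bool
  memberFreeᵉ k N m es = not (inD'ᵉ k (length es) (minusSign es) m) ∨ noIsotropicTriple (evenShape es m N)

  nonmemberIsotropicᵒ : ℕ → ℕ → ℕ → List Bool → Bool
  nonmemberIsotropicᵒ k N m bs = inD'ᵒ k (length bs) (signedOddity bs) m ∨ found (oddShape bs m N)

  nonmemberIsotropicᵉ : ℕ → ℕ → ℕ → List EBlock → Bool
  nonmemberIsotropicᵉ k N m es = inD'ᵉ k (length es) (minusSign es) m ∨ found (evenShape es m N)

  -- Only sorted residue lists are checked: permuting the cells is an isometry.
  membersFreeᵒ : ℕ → ℕ → Bool
  membersFreeᵒ k N = ∀≤ (oddCap k) λ n → ∀≤ k λ m → ∀≤ n λ a → memberFreeᵒ k N n m a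

  membersFreeᵉ : ℕ → ℕ → Bool
  membersFreeᵉ k N = ∀< k λ n → ∀≤ k λ m → all (memberFreeᵉ k N m) (blockLists (suc n))

  nonmembersIsotropicᵒ : ℕ → ℕ → Bool
  nonmembersIsotropicᵒ k N = ∀≤ (oddCap k) λ n → ∀≤ k λ m → all (nonmemberIsotropicᵒ k N m) (boolLists n)

  nonmembersIsotropicᵉ : ℕ → ℕ → Bool
  nonmembersIsotropicᵉ k N = ∀< k λ n → ∀≤ k λ m → all (nonmemberIsotropicᵉ k N m) (blockLists (suc n))

  longIsotropicᵒ : ℕ → ℕ → Bool
  longIsotropicᵒ k N = all (λ bs → found (oddShape bs 0 N)) (boolLists (suc (oddCap k)))

  longIsotropicᵉ : ℕ → ℕ → Bool
  longIsotropicᵉ k N = all (λ es → found (evenShape es 0 N)) (blockLists (suc k))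

  manyScale4Isotropic : ℕ → ℕ → Bool
  manyScale4Isotropic k N = found (shape [] (suc k) N)


module TableFacts where

  open import Defs using (U; V)
  open Cells
  open Search
  open Tables
  open import Data.Bool using (Bool; true; false; _∧_; _∨_; not; T)
  open import Data.Bool.ListAction using (all)
  open import Data.Maybe using (just)
  open import Data.Nat using (ℕ; zero; suc; _+_; _∸_; _≤_; _<_; _≤ᵇ_; z≤n; s≤s; _<?_)
  open import Data.Nat.Properties
    using (≤ᵇ⇒≤; ≤-trans; ≤-reflexive; m≤m+n; m+n∸m≡n; +-suc; ≮⇒≥; m≤n⇒m⊓n≡m)
  open import Data.List using (List; []; _∷_; map; replicate; length; take)
  open import Data.List.Properties using (length-take)
  open import Data.List.Membership.Propositional using (_∈_)
  open import Data.List.Membership.Propositional.Properties using (∈-upTo⁺; ∈-++⁺ˡ; ∈-++⁺ʳ; ∈-map⁺)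
  open import Data.List.Relation.Binary.Permutation.Propositional as Perm using (_↭_)
  import Data.List.Relation.Binary.Permutation.Propositional.Properties as Permₚ
  open import Data.List.Relation.Binary.Sublist.Propositional using (_⊆_; _∷_; ⊆-refl)
  import Data.List.Relation.Binary.Sublist.Propositional.Properties as Sub
  open import Data.List.Relation.Unary.Any using (here)
  open import Data.Sum using (_⊎_; inj₁; inj₂)
  open import Data.Empty using (⊥-elim)
  open import Data.Product using (_×_; _,_; proj₁; proj₂)
  open import Relation.Binary.PropositionalEquality using (_≡_; refl; sym; trans; cong; subst)
  open import Relation.Nullary using (¬_; yes; no)
  open import Function using (_∘_)
  open import Function.Bundles using (Equivalence)
  open import Data.Bool.Properties using (T-∧; T-≡)
  open import Relation.Nullary.Decidable using (T?)

  ∀≤-elim : ∀ {n} p {i} → T (∀≤ n p) → i ≤ n → T (p i)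
  ∀≤-elim p t i≤n = all-∈ p t (∈-upTo⁺ (s≤s i≤n))

  ∀<-elim : ∀ {n} p {i} → T (∀< n p) → i < n → T (p i)
  ∀<-elim p t i<n = all-∈ p t (∈-upTo⁺ i<n)

  ∈-boolLists : ∀ bs → bs ∈ boolLists (length bs)
  ∈-boolLists []           = here refl
  ∈-boolLists (true  ∷ bs) = ∈-++⁺ˡ (∈-map⁺ (true ∷_) (∈-boolLists bs))
  ∈-boolLists (false ∷ bs) = ∈-++⁺ʳ (map (true ∷_) (boolLists (length bs))) (∈-map⁺ (false ∷_) (∈-boolLists bs))

  ∈-blockLists : ∀ es → es ∈ blockLists (length es)
  ∈-blockLists []       = here refl
  ∈-blockLists (U ∷ es) = ∈-++⁺ˡ (∈-map⁺ (U ∷_) (∈-blockLists es))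
  ∈-blockLists (V ∷ es) = ∈-++⁺ʳ (map (U ∷_) (blockLists (length es))) (∈-map⁺ (V ∷_) (∈-blockLists es))

  fromFound : ∀ cs → T (found cs) → HasIsotropic3 cs
  fromFound cs t with findIsotropicTriple cs
  ... | just i = i

  T-ok : ∀ {b} → b ≡ true → T b
  T-ok = Equivalence.from T-≡

  implies : ∀ {p q} → T (not p ∨ q) → T p → T q
  implies {true} t _ = t

  otherwise : ∀ {p q} → T (p ∨ q) → ¬ T p → T q
  otherwise {true}  _ ¬p = ⊥-elim (¬p _)
    where open import Data.Empty using (⊥-elim)
  otherwise {false} q _  = q

  length≡counts : ∀ bs → length bs ≡ count₁ bs + count₃ bs
  length≡counts []           = refl
  length≡counts (true  ∷ bs) = cong suc (length≡counts bs)
  length≡counts (false ∷ bs) = trans (cong suc (length≡counts bs)) (sym (+-suc (count₁ bs) (count₃ bs)))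

  ↭-sorted : ∀ bs → bs ↭ sorted (count₁ bs) (count₃ bs)
  ↭-sorted []           = Perm.refl
  ↭-sorted (true  ∷ bs) = Perm.prep true (↭-sorted bs)
  ↭-sorted (false ∷ bs) = Perm.trans (Perm.prep false (↭-sorted bs))
                                      (Perm.↭-sym (Permₚ.shift false (replicate (count₁ bs) true) (replicate (count₃ bs) false)))

  replicate-⊆ : ∀ {A : Set} (x : A) {a b} → a ≤ b → replicate a x ⊆ replicate b x
  replicate-⊆ x {zero}  {b}     z≤n       = Sub.[]⊆-universal (replicate b x)
  replicate-⊆ x {suc a} {suc b} (s≤s a≤b) = refl ∷ replicate-⊆ x a≤b

  shape-⊆ : ∀ {s₁ s₂ m₁ m₂} N → s₁ ⊆ s₂ → m₁ ≤ m₂ → shape s₁ m₁ N ⊆ shape s₂ m₂ N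
  shape-⊆ N σ m₁≤m₂ = Sub.++⁺ σ (Sub.++⁺ (replicate-⊆ (line 2) m₁≤m₂) ⊆-refl)

  inD'ᵒ-bounds : ∀ k n e m → T (inD'ᵒ k n e m) → n ≤ oddCap k × m ≤ k
  inD'ᵒ-bounds k n e m p = ≤ᵇ⇒≤ n (oddCap k) n≤ , ≤ᵇ⇒≤ m k (proj₂ (split (memberᵒ k n e m) rest))
    where
    split : ∀ a {b} → T (a ∧ b) → T a × T b
    split a = Equivalence.to (T-∧ {a})
    n≤   = proj₁ (split (n ≤ᵇ oddCap k) p)
    rest = proj₂ (split (n ≤ᵇ oddCap k) p)

  inD'ᵉ-bounds : ∀ k b v m → T (inD'ᵉ k b v m) → b ≤ k × m ≤ k
  inD'ᵉ-bounds k b v m p = ≤ᵇ⇒≤ b k b≤ , ≤ᵇ⇒≤ m k (proj₂ (split (memberᵉ k b v m) rest))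
    where
    split : ∀ a {b} → T (a ∧ b) → T a × T b
    split a = Equivalence.to (T-∧ {a})
    b≤   = proj₁ (split (b ≤ᵇ k) p)
    rest = proj₂ (split (b ≤ᵇ k) p)

  module _ {k N : ℕ} where

    membersFreeᵒ-sound : T (membersFreeᵒ k N) → ∀ bs m →
                         T (inD'ᵒ k (length bs) (signedOddity bs) m) → ¬ HasIsotropic3 (oddShape bs m N)
    membersFreeᵒ-sound t bs m member =
      noIsotropicTriple-sound (oddShape (sorted a (count₃ bs)) m N) free
      ∘ transport (↭ᴵ (Permₚ.++⁺ʳ _ (Permₚ.map⁺ residueLine (↭-sorted bs))))
      where
      n = length bs
      a = count₁ bs
      n≤cap = proj₁ (inD'ᵒ-bounds k n (signedOddity bs) m member)
      m≤k   = proj₂ (inD'ᵒ-bounds k n (signedOddity bs) m member)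
      n∸a≡b : n ∸ a ≡ count₃ bs
      n∸a≡b = trans (cong (_∸ a) (length≡counts bs)) (m+n∸m≡n a (count₃ bs))
      a≤n : a ≤ n
      a≤n = ≤-trans (m≤m+n a (count₃ bs)) (≤-reflexive (sym (length≡counts bs)))
      entry : T (memberFreeᵒ k N n m a)
      entry = ∀≤-elim (memberFreeᵒ k N n m)
                (∀≤-elim (λ m → ∀≤ n (memberFreeᵒ k N n m))
                  (∀≤-elim (λ n → ∀≤ k λ m → ∀≤ n (memberFreeᵒ k N n m)) t n≤cap) m≤k) a≤n
      free = implies (subst (λ b → T (not (inD'ᵒ k n (signedOddityOf a b) m) ∨
                                      noIsotropicTriple (oddShape (sorted a b) m N))) n∸a≡b entry) member

    membersFreeᵉ-sound : T (membersFreeᵉ k N) → ∀ e es m → let es⁺ = e ∷ es in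
                         T (inD'ᵉ k (length es⁺) (minusSign es⁺) m) → ¬ HasIsotropic3 (evenShape es⁺ m N)
    membersFreeᵉ-sound t e es' m member =
      noIsotropicTriple-sound (evenShape (e ∷ es') m N) (implies (all-∈ (memberFreeᵉ k N m)
        (∀≤-elim (λ m → all (memberFreeᵉ k N m) (blockLists (suc (length es'))))
          (∀<-elim (λ n → ∀≤ k λ m → all (memberFreeᵉ k N m) (blockLists (suc n))) t n≤k) m≤k)
        (∈-blockLists (e ∷ es'))) member)
      where
      n≤k = proj₁ (inD'ᵉ-bounds k (length (e ∷ es')) (minusSign (e ∷ es')) m member)
      m≤k = proj₂ (inD'ᵉ-bounds k (length (e ∷ es')) (minusSign (e ∷ es')) m member)

    nonmembersIsotropicᵒ-sound : T (nonmembersIsotropicᵒ k N) → ∀ bs m → length bs ≤ oddCap k → m ≤ k →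
                                 ¬ T (inD'ᵒ k (length bs) (signedOddity bs) m) → HasIsotropic3 (oddShape bs m N)
    nonmembersIsotropicᵒ-sound t bs m n≤cap m≤k nonmember =
      fromFound (oddShape bs m N) (otherwise (all-∈ (nonmemberIsotropicᵒ k N m)
        (∀≤-elim (λ m → all (nonmemberIsotropicᵒ k N m) (boolLists (length bs)))
          (∀≤-elim (λ n → ∀≤ k λ m → all (nonmemberIsotropicᵒ k N m) (boolLists n)) t n≤cap) m≤k)
        (∈-boolLists bs)) nonmember)

    nonmembersIsotropicᵉ-sound : T (nonmembersIsotropicᵉ k N) → ∀ e es m → let es⁺ = e ∷ es in length es⁺ ≤ k → m ≤ k →
                                 ¬ T (inD'ᵉ k (length es⁺) (minusSign es⁺) m) → HasIsotropic3 (evenShape es⁺ m N)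
    nonmembersIsotropicᵉ-sound t e es' m n≤k m≤k nonmember =
      fromFound (evenShape (e ∷ es') m N) (otherwise (all-∈ (nonmemberIsotropicᵉ k N m)
        (∀≤-elim (λ m → all (nonmemberIsotropicᵉ k N m) (blockLists (suc (length es'))))
          (∀<-elim (λ n → ∀≤ k λ m → all (nonmemberIsotropicᵉ k N m) (blockLists (suc n))) t n≤k) m≤k)
        (∈-blockLists (e ∷ es'))) nonmember)

    longIsotropicᵒ-sound : T (longIsotropicᵒ k N) → ∀ bs → length bs ≡ suc (oddCap k) → HasIsotropic3 (oddShape bs 0 N)
    longIsotropicᵒ-sound t bs len =
      fromFound (oddShape bs 0 N) (all-∈ _ t (subst (λ n → bs ∈ boolLists n) len (∈-boolLists bs)))

    longIsotropicᵉ-sound : T (longIsotropicᵉ k N) → ∀ es → length es ≡ suc k → HasIsotropic3 (evenShape es 0 N)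
    longIsotropicᵉ-sound t es len =
      fromFound (evenShape es 0 N) (all-∈ _ t (subst (λ n → es ∈ blockLists n) len (∈-blockLists es)))

  record Verified (k N : ℕ) : Set where
    constructor verify
    field
      membersFreeᵒ-ok         : membersFreeᵒ k N ≡ true
      membersFreeᵉ-ok         : membersFreeᵉ k N ≡ true
      nonmembersIsotropicᵒ-ok : nonmembersIsotropicᵒ k N ≡ true
      nonmembersIsotropicᵉ-ok : nonmembersIsotropicᵉ k N ≡ true
      longIsotropicᵒ-ok       : longIsotropicᵒ k N ≡ true
      longIsotropicᵉ-ok       : longIsotropicᵉ k N ≡ true
      manyScale4Isotropic-ok  : manyScale4Isotropic k N ≡ true

  take-long : ∀ {A : Set} c (xs : List A) → c ≤ length xs → length (take c xs) ≡ c
  take-long c xs c≤n = trans (length-take c xs) (m≤n⇒m⊓n≡m c≤n)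

  -- Beyond the sizes occurring in 𝒟'_k an isotropic (ℤ/2)³ already lies in a sublist of
  -- bounded size, which is why finitely many tables decide membership.
  module _ {k N : ℕ} (v : Verified k N) where
    open Verified v

    many-scale4 : ∀ scale₂ {m} → k < m → HasIsotropic3 (shape scale₂ m N)
    many-scale4 scale₂ k<m =
      transport (⊆ᴵ (shape-⊆ N (Sub.[]⊆-universal scale₂) k<m)) (fromFound (shape [] (suc k) N) (T-ok manyScale4Isotropic-ok))

    decideᵒ : ∀ bs m → T (inD'ᵒ k (length bs) (signedOddity bs) m) ⊎ HasIsotropic3 (oddShape bs m N)
    decideᵒ bs m with oddCap k <? length bs | k <? m | T? (inD'ᵒ k (length bs) (signedOddity bs) m)
    ... | yes long | _ | _ =
      inj₂ (transport (⊆ᴵ (shape-⊆ N (Sub.map⁺ residueLine (Sub.take-⊆ c bs)) z≤n))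
                      (longIsotropicᵒ-sound {k} {N} (T-ok longIsotropicᵒ-ok) (take c bs) (take-long c bs long)))
      where c = suc (oddCap k)
    ... | no _     | yes many | _         = inj₂ (many-scale4 (map residueLine bs) many)
    ... | no _     | no _     | yes member = inj₁ member
    ... | no short | no few   | no nonmember =
      inj₂ (nonmembersIsotropicᵒ-sound {k} {N} (T-ok nonmembersIsotropicᵒ-ok) bs m (≮⇒≥ short) (≮⇒≥ few) nonmember)

    decideᵉ : ∀ e es m → let es⁺ = e ∷ es in
              T (inD'ᵉ k (length es⁺) (minusSign es⁺) m) ⊎ HasIsotropic3 (evenShape es⁺ m N)
    decideᵉ e es m with k <? length (e ∷ es) | k <? m | T? (inD'ᵉ k (length (e ∷ es)) (minusSign (e ∷ es)) m)
    ... | yes long | _ | _ =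
      inj₂ (transport (⊆ᴵ (shape-⊆ N (Sub.map⁺ livePlane (Sub.take-⊆ (suc k) (e ∷ es))) z≤n))
                      (longIsotropicᵉ-sound {k} {N} (T-ok longIsotropicᵉ-ok) (take (suc k) (e ∷ es)) (take-long (suc k) (e ∷ es) long)))
    ... | no _     | yes many | _         = inj₂ (many-scale4 (map livePlane (e ∷ es)) many)
    ... | no _     | no _     | yes member = inj₁ member
    ... | no short | no few   | no nonmember =
      inj₂ (nonmembersIsotropicᵉ-sound {k} {N} (T-ok nonmembersIsotropicᵉ-ok) e es m (≮⇒≥ short) (≮⇒≥ few) nonmember)

  verified : ∀ r → r < 3 → Verified (3 ∸ r) r
  verified 0 _ = verify refl refl refl refl refl refl refl
  verified 1 _ = verify refl refl refl refl refl refl refl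
  verified 2 _ = verify refl refl refl refl refl refl refl
  verified (suc (suc (suc _))) (s≤s (s≤s (s≤s ())))


module Parity where

  open import Defs using (bit)
  open import Data.Bool using (Bool; true; false; _∧_; _xor_; T)
  open import Data.Nat as ℕ using (ℕ; zero; suc)
  open import Data.Nat.Properties as ℕ using (≡ᵇ⇒≡; ≡⇒≡ᵇ)
  open import Data.Nat.DivMod using (m*n%n≡0; m≡m%n+[m/n]*n)
  open import Data.Integer using (ℤ; +_; -[1+_]; _+_; _*_; -_; ∣_∣)
  open import Data.Integer.Properties using (pos-+; pos-*; abs-*; +-identityˡ; +-identityʳ; *-identityʳ)
  open import Data.Integer.Tactic.RingSolver using (solve-∀)
  open import Data.Rational using (ℚ; _/_)
  import Data.Rational as ℚ
  open import Data.Rational.Properties using (toℚᵘ-injective; toℚᵘ-homo-+; toℚᵘ-fromℚᵘ; fromℚᵘ-cong)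
  open import Data.Rational.Unnormalised using (mkℚᵘ; *≡*)
  import Data.Rational.Unnormalised.Properties as ℚᵘ
  open import Data.Product using (∃-syntax; _,_)
  open import Data.Empty using (⊥-elim)
  open import Relation.Binary.PropositionalEquality using (_≡_; refl; sym; trans; cong; cong₂; subst)
  open import Relation.Nullary using (¬_)

  oddℕ : ℕ → Bool
  oddℕ zero          = false
  oddℕ (suc zero)    = true
  oddℕ (suc (suc n)) = oddℕ n

  halfℕ : ℕ → ℕ
  halfℕ zero          = zero
  halfℕ (suc zero)    = zero
  halfℕ (suc (suc n)) = suc (halfℕ n)

  parity : ℤ → Bool
  parity (+ n)     = oddℕ n
  parity -[1+ n ]  = oddℕ (suc n)

  -- Rounds towards -∞, so that k = 2 · half k + bit (parity k) holds for negative k too.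
  half : ℤ → ℤ
  half (+ n) = + halfℕ n
  half -[1+ n ] with oddℕ (suc n)
  ... | true  = - (+ suc (halfℕ (suc n)))
  ... | false = - (+ halfℕ (suc n))

  bitℕ : Bool → ℕ
  bitℕ true  = 1
  bitℕ false = 0

  halve-ℕ : ∀ n → n ≡ halfℕ n ℕ.+ halfℕ n ℕ.+ bitℕ (oddℕ n)
  halve-ℕ zero          = refl
  halve-ℕ (suc zero)    = refl
  halve-ℕ (suc (suc n)) = trans (cong (λ t → suc (suc t)) (halve-ℕ n))
    (sym (cong (λ t → suc t ℕ.+ bitℕ (oddℕ n)) (ℕ.+-suc (halfℕ n) (halfℕ n))))

  pos-+3 : ∀ a b c → + (a ℕ.+ b ℕ.+ c) ≡ + a + + b + + c
  pos-+3 a b c = trans (pos-+ (a ℕ.+ b) c) (cong (_+ + c) (pos-+ a b))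

  halve : ∀ k → k ≡ half k + half k + bit (parity k)
  halve (+ n) = trans (cong +_ (halve-ℕ n)) (trans (pos-+ (halfℕ n ℕ.+ halfℕ n) _)
    (cong₂ _+_ (pos-+ (halfℕ n) (halfℕ n)) (bitℕ≡bit (oddℕ n))))
    where
    bitℕ≡bit : ∀ b → + bitℕ b ≡ bit b
    bitℕ≡bit true  = refl
    bitℕ≡bit false = refl
  halve -[1+ n ] with oddℕ (suc n) | halve-ℕ (suc n)
  ... | true  | e = trans (cong (λ t → - (+ t)) e) (trans (cong -_ (pos-+3 H H 1)) (lemma (+ H)))
    where
    H = halfℕ (suc n)
    lemma : ∀ x → - (x + x + + 1) ≡ - (+ 1 + x) + - (+ 1 + x) + + 1
    lemma = solve-∀
  ... | false | e = trans (cong (λ t → - (+ t)) e) (trans (cong -_ (pos-+3 H H 0)) (lemma (+ H)))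
    where
    H = halfℕ (suc n)
    lemma : ∀ x → - (x + x + + 0) ≡ - x + - x + + 0
    lemma = solve-∀

  double≢1 : ∀ d → ¬ (d + d ≡ + 1)
  double≢1 d e = no-half ∣ d ∣ (trans (sym (abs-* d (+ 2))) (cong ∣_∣ (trans (lemma d) e)))
    where
    lemma : ∀ x → x * + 2 ≡ x + x
    lemma = solve-∀
    no-half : ∀ n → ¬ (n ℕ.* 2 ≡ 1)
    no-half zero    ()
    no-half (suc n) ()

  double≢-1 : ∀ d → ¬ (d + d ≡ - + 1)
  double≢-1 d e = double≢1 (- d) (trans (lemma d) (cong -_ e))
    where
    lemma : ∀ x → - x + - x ≡ - (x + x)
    lemma = solve-∀

  parity-unique : ∀ k h b → k ≡ h + h + bit b → parity k ≡ b
  parity-unique k h b e with parity k | half k | halve k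
  parity-unique k h true  e | true  | _  | _  = refl
  parity-unique k h false e | false | _  | _  = refl
  parity-unique k h false e | true  | h' | e' =
    ⊥-elim (double≢1 (h + - h') (trans (lemma h h') (trans (cong (λ t → t + - h' + - h') (sym e))
      (trans (cong (λ t → t + - h' + - h') e') (lemma₂ h')))))
    where
    lemma : ∀ a b → a + - b + (a + - b) ≡ a + a + + 0 + - b + - b
    lemma = solve-∀
    lemma₂ : ∀ b → b + b + + 1 + - b + - b ≡ + 1
    lemma₂ = solve-∀
  parity-unique k h true e | false | h' | e' =
    ⊥-elim (double≢-1 (h + - h') (trans (lemma h h') (trans (cong (λ t → t + - h' + - h' + - (+ 1)) (sym e))
      (trans (cong (λ t → t + - h' + - h' + - (+ 1)) e') (lemma₂ h')))))
    where
    lemma : ∀ a b → a + - b + (a + - b) ≡ a + a + + 1 + - b + - b + - (+ 1)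
    lemma = solve-∀
    lemma₂ : ∀ b → b + b + + 0 + - b + - b + - (+ 1) ≡ - (+ 1)
    lemma₂ = solve-∀

  parity-bit : ∀ b → parity (bit b) ≡ b
  parity-bit true  = refl
  parity-bit false = refl

  parity-+ : ∀ a b → parity (a + b) ≡ parity a xor parity b
  parity-+ a b with parity a | half a | halve a | parity b | half b | halve b
  ... | true  | A | ea | true  | B | eb = parity-unique _ (A + B + + 1) false (trans (cong₂ _+_ ea eb) (lemma A B))
    where lemma : ∀ A B → A + A + + 1 + (B + B + + 1) ≡ A + B + + 1 + (A + B + + 1) + + 0
          lemma = solve-∀
  ... | true  | A | ea | false | B | eb = parity-unique _ (A + B) true (trans (cong₂ _+_ ea eb) (lemma A B))
    where lemma : ∀ A B → A + A + + 1 + (B + B + + 0) ≡ A + B + (A + B) + + 1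
          lemma = solve-∀
  ... | false | A | ea | true  | B | eb = parity-unique _ (A + B) true (trans (cong₂ _+_ ea eb) (lemma A B))
    where lemma : ∀ A B → A + A + + 0 + (B + B + + 1) ≡ A + B + (A + B) + + 1
          lemma = solve-∀
  ... | false | A | ea | false | B | eb = parity-unique _ (A + B) false (trans (cong₂ _+_ ea eb) (lemma A B))
    where lemma : ∀ A B → A + A + + 0 + (B + B + + 0) ≡ A + B + (A + B) + + 0
          lemma = solve-∀

  parity-* : ∀ a b → parity (a * b) ≡ parity a ∧ parity b
  parity-* a b with parity a | half a | halve a | parity b | half b | halve b
  ... | true  | A | ea | true  | B | eb =
    parity-unique _ (A * B + A * B + A + B) true (trans (cong₂ _*_ ea eb) (lemma A B))
    where lemma : ∀ A B → (A + A + + 1) * (B + B + + 1) ≡ A * B + A * B + A + B + (A * B + A * B + A + B) + + 1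
          lemma = solve-∀
  ... | true  | A | ea | false | B | eb =
    parity-unique _ (A * B + A * B + B) false (trans (cong₂ _*_ ea eb) (lemma A B))
    where lemma : ∀ A B → (A + A + + 1) * (B + B + + 0) ≡ A * B + A * B + B + (A * B + A * B + B) + + 0
          lemma = solve-∀
  ... | false | A | ea | true  | B | eb =
    parity-unique _ (A * B + A * B + A) false (trans (cong₂ _*_ ea eb) (lemma A B))
    where lemma : ∀ A B → (A + A + + 0) * (B + B + + 1) ≡ A * B + A * B + A + (A * B + A * B + A) + + 0
          lemma = solve-∀
  ... | false | A | ea | false | B | eb =
    parity-unique _ (A * B + A * B) false (trans (cong₂ _*_ ea eb) (lemma A B))
    where lemma : ∀ A B → (A + A + + 0) * (B + B + + 0) ≡ A * B + A * B + (A * B + A * B) + + 0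
          lemma = solve-∀

  parity-neg : ∀ k → parity (- k) ≡ parity k
  parity-neg k with parity k | half k | halve k
  ... | b | H | e = parity-unique (- k) (- H + - bit b) b (trans (cong -_ e) (lemma H (bit b)))
    where lemma : ∀ H c → - (H + H + c) ≡ - H + - c + (- H + - c) + c
          lemma = solve-∀

  infix 4 _≡₄_
  record _≡₄_ (a b : ℤ) : Set where
    constructor mod4
    field
      quotient : ℤ
      proof    : a ≡ b + quotient * + 4

  ≡₄-refl : ∀ {a} → a ≡₄ a
  ≡₄-refl {a} = mod4 (+ 0) (sym (+-identityʳ a))

  ≡₄-reflexive : ∀ {a b} → a ≡ b → a ≡₄ b
  ≡₄-reflexive refl = ≡₄-refl

  ≡₄-sym : ∀ {a b} → a ≡₄ b → b ≡₄ a
  ≡₄-sym {a} {b} (mod4 t e) = mod4 (- t) (trans (lemma b t) (cong (λ x → x + - t * + 4) (sym e)))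
    where lemma : ∀ b t → b ≡ b + t * + 4 + - t * + 4
          lemma = solve-∀

  ≡₄-trans : ∀ {a b c} → a ≡₄ b → b ≡₄ c → a ≡₄ c
  ≡₄-trans {c = c} (mod4 t e) (mod4 t' e') = mod4 (t' + t) (trans e (trans (cong (λ x → x + t * + 4) e') (lemma c t t')))
    where lemma : ∀ c t t' → c + t' * + 4 + t * + 4 ≡ c + (t' + t) * + 4
          lemma = solve-∀

  ≡₄-+ : ∀ {a b c d} → a ≡₄ b → c ≡₄ d → a + c ≡₄ b + d
  ≡₄-+ {b = b} {d = d} (mod4 t e) (mod4 t' e') = mod4 (t + t') (trans (cong₂ _+_ e e') (lemma b d t t'))
    where lemma : ∀ b d t t' → b + t * + 4 + (d + t' * + 4) ≡ b + d + (t + t') * + 4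
          lemma = solve-∀

  ≡₄-*ˡ : ∀ c {a b} → a ≡₄ b → c * a ≡₄ c * b
  ≡₄-*ˡ c {b = b} (mod4 t e) = mod4 (c * t) (trans (cong (c *_) e) (lemma c b t))
    where lemma : ∀ c b t → c * (b + t * + 4) ≡ c * b + c * t * + 4
          lemma = solve-∀

  ≡₄-multiple : ∀ t → t * + 4 ≡₄ + 0
  ≡₄-multiple t = mod4 t (sym (+-identityˡ _))

  double≡₄ : ∀ k → + 2 * k ≡₄ + 2 * bit (parity k)
  double≡₄ k with parity k | half k | halve k
  ... | b | H | e = mod4 H (trans (cong (+ 2 *_) e) (lemma H (bit b)))
    where lemma : ∀ H c → + 2 * (H + H + c) ≡ + 2 * c + H * + 4
          lemma = solve-∀

  square≡₄ : ∀ k → k * k ≡₄ bit (parity k)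
  square≡₄ k with parity k | half k | halve k
  ... | true  | H | e = mod4 (H * H + H) (trans (cong₂ _*_ e e) (lemma H))
    where lemma : ∀ H → (H + H + + 1) * (H + H + + 1) ≡ + 1 + (H * H + H) * + 4
          lemma = solve-∀
  ... | false | H | e = mod4 (H * H) (trans (cong₂ _*_ e e) (lemma H))
    where lemma : ∀ H → (H + H + + 0) * (H + H + + 0) ≡ + 0 + (H * H) * + 4
          lemma = solve-∀

  quarter : ℤ → ℚ
  quarter w = w / 4

  /-cross : ∀ a b n m .{{_ : ℕ.NonZero n}} .{{_ : ℕ.NonZero m}} → a * + m ≡ b * + n → a / n ≡ b / m
  /-cross a b (suc n) (suc m) e = fromℚᵘ-cong {mkℚᵘ a n} {mkℚᵘ b m} (*≡* e)

  /-cross⁻¹ : ∀ a b n m .{{_ : ℕ.NonZero n}} .{{_ : ℕ.NonZero m}} → a / n ≡ b / m → a * + m ≡ b * + n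
  /-cross⁻¹ a b (suc n) (suc m) e with
    ℚᵘ.≃-trans (ℚᵘ.≃-sym (toℚᵘ-fromℚᵘ (mkℚᵘ a n)))
      (ℚᵘ.≃-trans (ℚᵘ.≃-reflexive (cong ℚ.toℚᵘ e)) (toℚᵘ-fromℚᵘ (mkℚᵘ b m)))
  ... | *≡* e' = e'

  quarter-+ : ∀ a b → quarter a ℚ.+ quarter b ≡ quarter (a + b)
  quarter-+ a b = toℚᵘ-injective
    (ℚᵘ.≃-trans (toℚᵘ-homo-+ (quarter a) (quarter b))
    (ℚᵘ.≃-trans (ℚᵘ.+-cong (toℚᵘ-fromℚᵘ (mkℚᵘ a 3)) (toℚᵘ-fromℚᵘ (mkℚᵘ b 3)))
    (ℚᵘ.≃-trans (*≡* (lemma a b)) (ℚᵘ.≃-sym (toℚᵘ-fromℚᵘ (mkℚᵘ (a + b) 3))))))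
    where lemma : ∀ a b → (a * + 4 + b * + 4) * + 4 ≡ (a + b) * (+ 4 * + 4)
          lemma = solve-∀

  quarter-0 : ℚ.0ℚ ≡ quarter (+ 0)
  quarter-0 = /-cross (+ 0) (+ 0) 1 4 refl

  integral-quarter⇒ : ∀ w → ∃[ z ] quarter w ≡ z / 1 → w ≡₄ + 0
  integral-quarter⇒ w (z , e) = mod4 z (trans (trans (sym (*-identityʳ w)) (/-cross⁻¹ w z 4 1 e)) (sym (+-identityˡ _)))

  integral-quarter⇐ : ∀ w → w ≡₄ + 0 → ∃[ z ] quarter w ≡ z / 1
  integral-quarter⇐ w (mod4 t e) = t , /-cross w t 4 1 (trans (*-identityʳ w) (trans e (+-identityˡ _)))

  ≡₄-zero⇒ : ∀ n → + n ≡₄ + 0 → T (n ℕ.% 4 ℕ.≡ᵇ 0)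
  ≡₄-zero⇒ n (mod4 t e) = ≡⇒≡ᵇ _ _ (subst (λ m → m ℕ.% 4 ≡ 0) (sym n≡4∣t∣) (m*n%n≡0 ∣ t ∣ 4))
    where
    n≡4∣t∣ : n ≡ ∣ t ∣ ℕ.* 4
    n≡4∣t∣ = trans (cong ∣_∣ (trans e (+-identityˡ (t * + 4)))) (abs-* t (+ 4))

  ≡₄-zero⇐ : ∀ n → T (n ℕ.% 4 ℕ.≡ᵇ 0) → + n ≡₄ + 0
  ≡₄-zero⇐ n t = mod4 (+ (n ℕ./ 4)) (trans (cong +_ n≡) (trans (pos-* (n ℕ./ 4) 4) (sym (+-identityˡ (+ (n ℕ./ 4) * + 4)))))
    where
    n≡ : n ≡ (n ℕ./ 4) ℕ.* 4
    n≡ = trans (m≡m%n+[m/n]*n n 4) (cong (ℕ._+ (n ℕ./ 4) ℕ.* 4) (≡ᵇ⇒≡ (n ℕ.% 4) 0 t))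


module TwoTorsion where

  open import Defs
  open Cells
  open Parity
  open import Data.Bool using (Bool; true; false; _∧_; _∨_; _xor_; not; T; if_then_else_)
  open import Data.Bool.Properties using (∧-idem; T-∧)
  open import Data.Nat as ℕ using (ℕ; zero; suc)
  open import Data.Nat.Properties using (m^n≢0; +-suc; +-identityʳ)
  open import Data.Integer as ℤ using (ℤ; +_; _+_; _*_; _-_)
  open import Data.Integer.Properties as ℤ using (pos-+; pos-*)
  open import Data.Integer.Tactic.RingSolver using (solve-∀)
  import Data.Integer.Divisibility.Signed as Signed
  open import Data.Integer.Divisibility using () renaming (_∣_ to _∣ℤ_)
  open import Data.List using (List; []; _∷_; map)
  open import Data.Maybe using (Maybe; just; nothing)
  open import Data.Product using (Σ-syntax; ∃-syntax; _×_; _,_; proj₁; proj₂)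
  open import Data.Unit using (⊤; tt)
  open import Data.Empty using (⊥-elim)
  open import Function.Bundles using (Equivalence)
  open import Function using (_∘_)
  open import Relation.Binary.PropositionalEquality
  open import Relation.Nullary using (¬_)
  import Data.Rational as ℚ

  -- Whether u = 2m + 1 is 1 mod 4.
  residue : ℕ → Bool
  residue m = not (oddℕ m)

  lineValue : ℕ → ℕ → ℕ
  lineValue zero          m = if residue m then 1 else 3
  lineValue (suc zero)    _ = 2
  lineValue (suc (suc _)) _ = 0

  liveAt : ℕ → EBlock → Maybe EBlock
  liveAt zero    e = just e
  liveAt (suc _) _ = nothing

  cellOf : Atom → Cell
  cellOf (atom j (cyc m)) = line (lineValue j m)
  cellOf (atom j blkU)    = plane (liveAt j U)
  cellOf (atom j blkV)    = plane (liveAt j V)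

  cells : List Atom → List Cell
  cells = map cellOf

  pow : ℕ → ℤ
  pow j = + pow2 j

  pow-suc : ∀ j → pow (suc j) ≡ + 2 * pow j
  pow-suc j = pos-* 2 (pow2 j)

  pow-nonZero : ∀ j → ℤ.NonZero (pow j)
  pow-nonZero j = m^n≢0 2 j

  -- In ℤ/2^(j+1) the elements of order dividing 2 are the 2^j·k; k is their lift.
  Lifts : (j : ℕ) (b : Block) → BElem b → BElem b → Set
  Lifts j (cyc _) k x             = x ≡ pow j * k
  Lifts j blkU    (k , l) (x , y) = (x ≡ pow j * k) × (y ≡ pow j * l)
  Lifts j blkV    (k , l) (x , y) = (x ≡ pow j * k) × (y ≡ pow j * l)

  LiftsA : (as : List Atom) → AElem as → AElem as → Set
  LiftsA []              _        _        = ⊤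
  LiftsA (atom j b ∷ as) (k , ks) (x , xs) = Lifts j b k x × LiftsA as ks xs

  divides⇒ : ∀ {n z} → (+ n) ∣ℤ z → ∃[ q ] z ≡ q * + n
  divides⇒ d with Signed.∣ᵤ⇒∣ d
  ... | Signed.divides q e = q , e

  ⇒divides : ∀ {n z} q → z ≡ q * + n → (+ n) ∣ℤ z
  ⇒divides q e = Signed.∣⇒∣ᵤ (Signed.divides q e)

  order2⇒lift : ∀ j x → (+ pow2 (suc j)) ∣ℤ (+ 2 * x - + 0) → ∃[ k ] x ≡ pow j * k
  order2⇒lift j x d with divides⇒ d
  ... | q , e = q , ℤ.*-cancelˡ-≡ (+ 2) x (pow j * q)
    (trans (sym (ℤ.+-identityʳ (+ 2 * x))) (trans e (trans (cong (q *_) (pow-suc j)) (lemma q (pow j)))))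
    where lemma : ∀ q c → q * (+ 2 * c) ≡ + 2 * (c * q)
          lemma = solve-∀

  lift⇒order2 : ∀ j x k → x ≡ pow j * k → (+ pow2 (suc j)) ∣ℤ (+ 2 * x - + 0)
  lift⇒order2 j x k e =
    ⇒divides k (trans (cong (λ t → + 2 * t - + 0) e) (trans (lemma k (pow j)) (cong (k *_) (sym (pow-suc j)))))
    where lemma : ∀ k c → + 2 * (c * k) - + 0 ≡ k * (+ 2 * c)
          lemma = solve-∀

  order2⇒liftA : ∀ as x → EqA as (smulA as (+ 2) x) (zeroA as) → Σ[ k ∈ AElem as ] LiftsA as k x
  order2⇒liftA []                    _        _        = tt , tt
  order2⇒liftA (atom j (cyc _) ∷ as) (x , xs) (d , ds)
    with order2⇒lift j x d | order2⇒liftA as xs ds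
  ... | k , e | ks , es = (k , ks) , e , es
  order2⇒liftA (atom j blkU ∷ as) ((x , y) , xs) ((d , d') , ds)
    with order2⇒lift j x d | order2⇒lift j y d' | order2⇒liftA as xs ds
  ... | k , e | l , e' | ks , es = ((k , l) , ks) , (e , e') , es
  order2⇒liftA (atom j blkV ∷ as) ((x , y) , xs) ((d , d') , ds)
    with order2⇒lift j x d | order2⇒lift j y d' | order2⇒liftA as xs ds
  ... | k , e | l , e' | ks , es = ((k , l) , ks) , (e , e') , es

  lift⇒order2A : ∀ as k x → LiftsA as k x → EqA as (smulA as (+ 2) x) (zeroA as)
  lift⇒order2A []                    _ _ _ = tt
  lift⇒order2A (atom j (cyc _) ∷ as) (k , ks) (x , xs) (e , es) =
    lift⇒order2 j x k e , lift⇒order2A as ks xs es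
  lift⇒order2A (atom j blkU ∷ as) ((k , l) , ks) ((x , y) , xs) ((e , e') , es) =
    (lift⇒order2 j x k e , lift⇒order2 j y l e') , lift⇒order2A as ks xs es
  lift⇒order2A (atom j blkV ∷ as) ((k , l) , ks) ((x , y) , xs) ((e , e') , es) =
    (lift⇒order2 j x k e , lift⇒order2 j y l e') , lift⇒order2A as ks xs es

  reduceᵇ : (j : ℕ) (b : Block) → BElem b → Coords (cellOf (atom j b))
  reduceᵇ j (cyc _) k       = parity k
  reduceᵇ j blkU    (k , l) = parity k , parity l
  reduceᵇ j blkV    (k , l) = parity k , parity l

  reduce : (as : List Atom) → AElem as → Vect (cells as)
  reduce []              _        = tt
  reduce (atom j b ∷ as) (k , ks) = reduceᵇ j b k , reduce as ks

  even-lift⇒zero : ∀ j w k → w ≡ pow j * k → parity k ≡ false → (+ pow2 (suc j)) ∣ℤ (w - + 0)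
  even-lift⇒zero j w k e even with parity k | half k | halve k
  even-lift⇒zero j w k e refl | false | H | k≡ =
    ⇒divides H (trans (cong (_- + 0) (trans e (cong (pow j *_) k≡)))
      (trans (lemma H (pow j)) (cong (H *_) (sym (pow-suc j)))))
    where lemma : ∀ H c → c * (H + H + + 0) - + 0 ≡ H * (+ 2 * c)
          lemma = solve-∀

  zero⇒even-lift : ∀ j w k → w ≡ pow j * k → (+ pow2 (suc j)) ∣ℤ (w - + 0) → parity k ≡ false
  zero⇒even-lift j w k e d with divides⇒ d
  ... | q , e' = parity-unique k q false (ℤ.*-cancelˡ-≡ (pow j) k (q + q + + 0) {{pow-nonZero j}}
    (trans (sym e) (trans (sym (ℤ.+-identityʳ w)) (trans e' (trans (cong (q *_) (pow-suc j)) (lemma q (pow j)))))))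
    where lemma : ∀ q c → q * (+ 2 * c) ≡ c * (q + q + + 0)
          lemma = solve-∀

  private
    ∨≡false : ∀ {a b} → a ∨ b ≡ false → a ≡ false × b ≡ false
    ∨≡false {false} {false} _ = refl , refl

    false∨false : ∀ {a b} → a ≡ false → b ≡ false → a ∨ b ≡ false
    false∨false refl refl = refl

  reduce-zero⇒zero : ∀ as k w → LiftsA as k w → nonzero (cells as) (reduce as k) ≡ false → EqA as w (zeroA as)
  reduce-zero⇒zero [] _ _ _ _ = tt
  reduce-zero⇒zero (atom j (cyc _) ∷ as) (k , ks) (w , ws) (e , es) zr =
    even-lift⇒zero j w k e (proj₁ (∨≡false zr)) , reduce-zero⇒zero as ks ws es (proj₂ (∨≡false zr))
  reduce-zero⇒zero (atom j blkU ∷ as) ((k , l) , ks) ((w , w') , ws) ((e , e') , es) zr =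
    let z₁ , z₂ = ∨≡false zr ; k₀ , l₀ = ∨≡false z₁ in
    (even-lift⇒zero j w k e k₀ , even-lift⇒zero j w' l e' l₀) , reduce-zero⇒zero as ks ws es z₂
  reduce-zero⇒zero (atom j blkV ∷ as) ((k , l) , ks) ((w , w') , ws) ((e , e') , es) zr =
    let z₁ , z₂ = ∨≡false zr ; k₀ , l₀ = ∨≡false z₁ in
    (even-lift⇒zero j w k e k₀ , even-lift⇒zero j w' l e' l₀) , reduce-zero⇒zero as ks ws es z₂

  zero⇒reduce-zero : ∀ as k w → LiftsA as k w → EqA as w (zeroA as) → nonzero (cells as) (reduce as k) ≡ false
  zero⇒reduce-zero [] _ _ _ _ = refl
  zero⇒reduce-zero (atom j (cyc _) ∷ as) (k , ks) (w , ws) (e , es) (d , ds) =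
    false∨false (zero⇒even-lift j w k e d) (zero⇒reduce-zero as ks ws es ds)
  zero⇒reduce-zero (atom j blkU ∷ as) ((k , l) , ks) ((w , w') , ws) ((e , e') , es) ((d , d') , ds) =
    false∨false (false∨false (zero⇒even-lift j w k e d) (zero⇒even-lift j w' l e' d')) (zero⇒reduce-zero as ks ws es ds)
  zero⇒reduce-zero (atom j blkV ∷ as) ((k , l) , ks) ((w , w') , ws) ((e , e') , es) ((d , d') , ds) =
    false∨false (false∨false (zero⇒even-lift j w k e d) (zero⇒even-lift j w' l e' d')) (zero⇒reduce-zero as ks ws es ds)

  private
    oddℕ-suc-double : ∀ n → oddℕ (suc (n ℕ.+ n)) ≡ true
    oddℕ-suc-double zero    = refl
    oddℕ-suc-double (suc n) = trans (cong oddℕ (+-suc n n)) (oddℕ-suc-double n)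

    oddℕ-odd : ∀ m → oddℕ (suc (2 ℕ.* m)) ≡ true
    oddℕ-odd m = subst (λ t → oddℕ (suc (m ℕ.+ t)) ≡ true) (sym (+-identityʳ m)) (oddℕ-suc-double m)

    double-bit : ∀ {b c} → b ≡ c → + 2 * bit b ≡₄ + (if c then 2 else 0)
    double-bit {true}  refl = ≡₄-refl
    double-bit {false} refl = ≡₄-refl

    odd≡₄residue : ∀ m → + suc (2 ℕ.* m) ≡₄ + (if residue m then 1 else 3)
    odd≡₄residue m = ≡₄-trans (≡₄-reflexive (trans (pos-+ 1 (2 ℕ.* m)) (cong (λ t → + 1 + t) (pos-* 2 m))))
                              (≡₄-trans (≡₄-+ (≡₄-refl {+ 1}) (double≡₄ (+ m))) (by-parity (oddℕ m)))
      where
      by-parity : ∀ b → + 1 + + 2 * bit b ≡₄ + (if not b then 1 else 3)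
      by-parity true  = ≡₄-refl
      by-parity false = ≡₄-refl

    pow-suc-suc : ∀ j → pow (suc (suc j)) ≡ + 4 * pow j
    pow-suc-suc j = trans (pow-suc (suc j)) (trans (cong (+ 2 *_) (pow-suc j)) (sym (ℤ.*-assoc (+ 2) (+ 2) (pow j))))

    /-nonZero : ∀ n → ℕ.NonZero (pow2 n)
    /-nonZero n = m^n≢0 2 n

  formᵇ-lift : ∀ j b k w → Lifts j b k w →
               Σ[ W ∈ ℤ ] (qB j b w ≡ quarter W) × (W ≡₄ + formᶜ (cellOf (atom j b)) (reduceᵇ j b k))
  formᵇ-lift zero (cyc m) k w refl =
    u * w * w , refl ,
    ≡₄-trans (≡₄-reflexive (lemma u k)) (≡₄-trans (≡₄-*ˡ u (square≡₄ k)) (by-parity (parity k)))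
    where
    u = + suc (2 ℕ.* m)
    lemma : ∀ a k → a * (+ 1 * k) * (+ 1 * k) ≡ a * (k * k)
    lemma = solve-∀
    by-parity : ∀ b → u * bit b ≡₄ + (if b then (if residue m then 1 else 3) else 0)
    by-parity true  = ≡₄-trans (≡₄-reflexive (ℤ.*-identityʳ u)) (odd≡₄residue m)
    by-parity false = ≡₄-reflexive (ℤ.*-zeroʳ u)
  formᵇ-lift (suc zero) (cyc m) k w refl =
    + 2 * (u * (k * k)) , /-cross (u * w * w) (+ 2 * (u * (k * k))) 8 4 (lemma u k) ,
    ≡₄-trans (double≡₄ (u * (k * k)))
      (double-bit (trans (parity-* u (k * k)) (trans (cong₂ _∧_ (oddℕ-odd m) (parity-* k k)) (∧-idem (parity k)))))
    where
    u = + suc (2 ℕ.* m)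
    lemma : ∀ a k → a * (+ 2 * k) * (+ 2 * k) * + 4 ≡ + 2 * (a * (k * k)) * + 8
    lemma = solve-∀
  formᵇ-lift (suc (suc j)) (cyc m) k w refl =
    W * + 4 ,
    /-cross (u * w * w) (W * + 4) (pow2 (4 ℕ.+ j)) 4 {{/-nonZero (4 ℕ.+ j)}}
      (trans (cong (λ t → u * (t * k) * (t * k) * + 4) (pow-suc-suc j))
        (trans (lemma u k (pow j)) (cong (W * + 4 *_) (sym (trans (pow-suc-suc (2 ℕ.+ j)) (cong (+ 4 *_) (pow-suc-suc j))))))) ,
    ≡₄-trans (≡₄-multiple W) (≡₄-reflexive (cong +_ (sym (null-if (parity k)))))
    where
    u = + suc (2 ℕ.* m)
    W = u * (k * k) * pow j
    lemma : ∀ a k c → a * (+ 4 * c * k) * (+ 4 * c * k) * + 4 ≡ a * (k * k) * c * + 4 * (+ 4 * (+ 4 * c))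
    lemma = solve-∀
  formᵇ-lift zero blkU (k , k') (w , w') (refl , refl) =
    + 2 * (k * k') , /-cross (w * w') (+ 2 * (k * k')) 2 4 (lemma k k') ,
    ≡₄-trans (double≡₄ (k * k')) (double-bit (parity-* k k'))
    where
    lemma : ∀ k k' → + 1 * k * (+ 1 * k') * + 4 ≡ + 2 * (k * k') * + 2
    lemma = solve-∀
  formᵇ-lift (suc j) blkU (k , k') (w , w') (refl , refl) =
    W * + 4 ,
    /-cross (w * w') (W * + 4) (pow2 (2 ℕ.+ j)) 4 {{/-nonZero (2 ℕ.+ j)}}
      (trans (cong₂ (λ a b → a * k * (b * k') * + 4) (pow-suc j) (pow-suc j))
        (trans (lemma k k' (pow j)) (cong (W * + 4 *_) (sym (pow-suc-suc j))))) ,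
    ≡₄-multiple W
    where
    W = k * k' * pow j
    lemma : ∀ k k' c → + 2 * c * k * (+ 2 * c * k') * + 4 ≡ k * k' * c * + 4 * (+ 4 * c)
    lemma = solve-∀
  formᵇ-lift zero blkV (k , k') (w , w') (refl , refl) =
    + 2 * N , /-cross (w * w + w * w' + w' * w') (+ 2 * N) 2 4 (lemma k k') ,
    ≡₄-trans (double≡₄ N) (double-bit (trans (parity-+ (k * k + k * k') (k' * k'))
      (trans (cong₂ _xor_ (trans (parity-+ (k * k) (k * k')) (cong₂ _xor_ (parity-* k k) (parity-* k k'))) (parity-* k' k'))
             (norm-parity (parity k) (parity k')))))
    where
    N = k * k + k * k' + k' * k'
    lemma : ∀ k k' → (+ 1 * k * (+ 1 * k) + + 1 * k * (+ 1 * k') + + 1 * k' * (+ 1 * k')) * + 4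
                   ≡ + 2 * (k * k + k * k' + k' * k') * + 2
    lemma = solve-∀
    norm-parity : ∀ a b → ((a ∧ a) xor (a ∧ b)) xor (b ∧ b) ≡ a ∨ b
    norm-parity true  true  = refl
    norm-parity true  false = refl
    norm-parity false b     = ∧-idem b
  formᵇ-lift (suc j) blkV (k , k') (w , w') (refl , refl) =
    W * + 4 ,
    /-cross (w * w + w * w' + w' * w') (W * + 4) (pow2 (2 ℕ.+ j)) 4 {{/-nonZero (2 ℕ.+ j)}}
      (trans (cong₂ (λ a b → (a * k * (a * k) + a * k * (b * k') + b * k' * (b * k')) * + 4) (pow-suc j) (pow-suc j))
        (trans (lemma k k' (pow j)) (cong (W * + 4 *_) (sym (pow-suc-suc j))))) ,
    ≡₄-multiple W
    where
    W = (k * k + k * k' + k' * k') * pow j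
    lemma : ∀ k k' c → (+ 2 * c * k * (+ 2 * c * k) + + 2 * c * k * (+ 2 * c * k') + + 2 * c * k' * (+ 2 * c * k')) * + 4
                     ≡ (k * k + k * k' + k' * k') * c * + 4 * (+ 4 * c)
    lemma = solve-∀

  form-lift : ∀ as k w → LiftsA as k w →
              Σ[ W ∈ ℤ ] (qA as w ≡ quarter W) × (W ≡₄ + form (cells as) (reduce as k))
  form-lift []              _        _        _        = + 0 , quarter-0 , ≡₄-refl
  form-lift (atom j b ∷ as) (k , ks) (w , ws) (e , es) with formᵇ-lift j b k w e | form-lift as ks ws es
  ... | W , qw , W≡ | S , qs , S≡ =
    W + S , trans (cong₂ ℚ._+_ qw qs) (quarter-+ W S) ,
    ≡₄-trans (≡₄-+ W≡ S≡) (≡₄-reflexive (sym (pos-+ (formᶜ (cellOf (atom j b)) (reduceᵇ j b k)) _)))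

  combinationA : (as : List Atom) → Bool → Bool → Bool → AElem as → AElem as → AElem as → AElem as
  combinationA as a b c x y z₀ = addA as (addA as (smulA as (bit a) x) (smulA as (bit b) y)) (smulA as (bit c) z₀)

  private
    lift-combination₁ : ∀ j {x y z₀ kx ky kz} (A B C : ℤ) → x ≡ pow j * kx → y ≡ pow j * ky → z₀ ≡ pow j * kz →
                        A * x + B * y + C * z₀ ≡ pow j * (A * kx + B * ky + C * kz)
    lift-combination₁ j {kx = kx} {ky} {kz} A B C refl refl refl = lemma (pow j) A B C kx ky kz
      where lemma : ∀ c A B C x y z₀ → A * (c * x) + B * (c * y) + C * (c * z₀) ≡ c * (A * x + B * y + C * z₀)
            lemma = solve-∀

    parity-combination₁ : ∀ a b c x y z₀ →
      parity (bit a * x + bit b * y + bit c * z₀) ≡ ((a ∧ parity x) xor (b ∧ parity y)) xor (c ∧ parity z₀)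
    parity-combination₁ a b c x y z₀ =
      trans (parity-+ (bit a * x + bit b * y) (bit c * z₀))
        (cong₂ _xor_ (trans (parity-+ (bit a * x) (bit b * y)) (cong₂ _xor_ (bit-* a x) (bit-* b y))) (bit-* c z₀))
      where bit-* : ∀ a x → parity (bit a * x) ≡ a ∧ parity x
            bit-* a x = trans (parity-* (bit a) x) (cong (_∧ parity x) (parity-bit a))

  LiftsA-combination : ∀ as {kx ky kz x y z₀} → LiftsA as kx x → LiftsA as ky y → LiftsA as kz z₀ → ∀ a b c →
                       LiftsA as (combinationA as a b c kx ky kz) (combinationA as a b c x y z₀)
  LiftsA-combination [] _ _ _ _ _ _ = tt
  LiftsA-combination (atom j (cyc _) ∷ as) (ex , exs) (ey , eys) (ez , ezs) a b c =
    lift-combination₁ j (bit a) (bit b) (bit c) ex ey ez , LiftsA-combination as exs eys ezs a b c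
  LiftsA-combination (atom j blkU ∷ as) ((ex , ex') , exs) ((ey , ey') , eys) ((ez , ez') , ezs) a b c =
    (lift-combination₁ j (bit a) (bit b) (bit c) ex ey ez , lift-combination₁ j (bit a) (bit b) (bit c) ex' ey' ez') ,
    LiftsA-combination as exs eys ezs a b c
  LiftsA-combination (atom j blkV ∷ as) ((ex , ex') , exs) ((ey , ey') , eys) ((ez , ez') , ezs) a b c =
    (lift-combination₁ j (bit a) (bit b) (bit c) ex ey ez , lift-combination₁ j (bit a) (bit b) (bit c) ex' ey' ez') ,
    LiftsA-combination as exs eys ezs a b c

  reduce-combination : ∀ as kx ky kz a b c →
    reduce as (combinationA as a b c kx ky kz) ≡ combination (cells as) a b c (reduce as kx) (reduce as ky) (reduce as kz)
  reduce-combination [] _ _ _ _ _ _ = refl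
  reduce-combination (atom j (cyc _) ∷ as) (x , xs) (y , ys) (z₀ , zs) a b c =
    cong₂ _,_ (parity-combination₁ a b c x y z₀) (reduce-combination as xs ys zs a b c)
  reduce-combination (atom j blkU ∷ as) ((x , x') , xs) ((y , y') , ys) ((z₀ , z') , zs) a b c =
    cong₂ _,_ (cong₂ _,_ (parity-combination₁ a b c x y z₀) (parity-combination₁ a b c x' y' z'))
              (reduce-combination as xs ys zs a b c)
  reduce-combination (atom j blkV ∷ as) ((x , x') , xs) ((y , y') , ys) ((z₀ , z') , zs) a b c =
    cong₂ _,_ (cong₂ _,_ (parity-combination₁ a b c x y z₀) (parity-combination₁ a b c x' y' z'))
              (reduce-combination as xs ys zs a b c)

  integral⇒form≡0 : ∀ as k w → LiftsA as k w → IsInt (qA as w) → T (form (cells as) (reduce as k) ℕ.% 4 ℕ.≡ᵇ 0)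
  integral⇒form≡0 as k w e int with form-lift as k w e
  ... | W , qw , W≡ = ≡₄-zero⇒ _ (≡₄-trans (≡₄-sym W≡) (integral-quarter⇒ W (subst IsInt qw int)))

  form≡0⇒integral : ∀ as k w → LiftsA as k w → T (form (cells as) (reduce as k) ℕ.% 4 ℕ.≡ᵇ 0) → IsInt (qA as w)
  form≡0⇒integral as k w e t with form-lift as k w e
  ... | W , qw , W≡ = subst IsInt (sym qw) (integral-quarter⇐ W (≡₄-trans W≡ (≡₄-zero⇐ _ t)))

  isotropic-lift⇒ : ∀ as k w → LiftsA as k w → ¬ EqA as w (zeroA as) → IsInt (qA as w) →
                    T (isotropic (cells as) (reduce as k))
  isotropic-lift⇒ as k w e w≢0 int = Equivalence.from T-∧ (nonzero-reduce , integral⇒form≡0 as k w e int)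
    where
    nonzero-reduce : T (nonzero (cells as) (reduce as k))
    nonzero-reduce with nonzero (cells as) (reduce as k) in eq
    ... | true  = tt
    ... | false = ⊥-elim (w≢0 (reduce-zero⇒zero as k w e eq))

  isotropic-lift⇐ : ∀ as k w → LiftsA as k w → T (isotropic (cells as) (reduce as k)) →
                    (¬ EqA as w (zeroA as)) × IsInt (qA as w)
  isotropic-lift⇐ as k w e t = nonzero-w , form≡0⇒integral as k w e (proj₂ split)
    where
    split = Equivalence.to (T-∧ {nonzero (cells as) (reduce as k)}) t
    nonzero-w : ¬ EqA as w (zeroA as)
    nonzero-w w≡0 = subst T (zero⇒reduce-zero as k w e w≡0) (proj₁ split)

  bitsᵇ : (j : ℕ) (b : Block) → Coords (cellOf (atom j b)) → BElem b
  bitsᵇ j (cyc _) a        = bit a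
  bitsᵇ j blkU    (a , a') = bit a , bit a'
  bitsᵇ j blkV    (a , a') = bit a , bit a'

  bits : (as : List Atom) → Vect (cells as) → AElem as
  bits []              _        = tt
  bits (atom j b ∷ as) (a , xs) = bitsᵇ j b a , bits as xs

  reduce-bits : ∀ as x → reduce as (bits as x) ≡ x
  reduce-bits []                    _              = refl
  reduce-bits (atom j (cyc _) ∷ as) (a , xs)       = cong₂ _,_ (parity-bit a) (reduce-bits as xs)
  reduce-bits (atom j blkU ∷ as)    ((a , b) , xs) = cong₂ _,_ (cong₂ _,_ (parity-bit a) (parity-bit b)) (reduce-bits as xs)
  reduce-bits (atom j blkV ∷ as)    ((a , b) , xs) = cong₂ _,_ (cong₂ _,_ (parity-bit a) (parity-bit b)) (reduce-bits as xs)

  liftᵇ : (j : ℕ) (b : Block) → BElem b → BElem b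
  liftᵇ j (cyc _) k       = pow j * k
  liftᵇ j blkU    (k , l) = pow j * k , pow j * l
  liftᵇ j blkV    (k , l) = pow j * k , pow j * l

  lift : (as : List Atom) → AElem as → AElem as
  lift []              _        = tt
  lift (atom j b ∷ as) (k , ks) = liftᵇ j b k , lift as ks

  LiftsA-lift : ∀ as k → LiftsA as k (lift as k)
  LiftsA-lift []                    _              = tt
  LiftsA-lift (atom j (cyc _) ∷ as) (k , ks)       = refl , LiftsA-lift as ks
  LiftsA-lift (atom j blkU ∷ as)    ((k , l) , ks) = (refl , refl) , LiftsA-lift as ks
  LiftsA-lift (atom j blkV ∷ as)    ((k , l) , ks) = (refl , refl) , LiftsA-lift as ks

  isotropicSubgroup⇒ : ∀ D → HasIsotropicZ2³ D → HasIsotropic3 (cells (atoms D))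
  isotropicSubgroup⇒ D (x , y , z₀ , 2x≡0 , 2y≡0 , 2z≡0 , injective , isotropic-image)
    with order2⇒liftA as x 2x≡0 | order2⇒liftA as y 2y≡0 | order2⇒liftA as z₀ 2z≡0
    where as = atoms D
  ... | kx , ex | ky , ey | kz , ez =
    reduce as kx , reduce as ky , reduce as kz ,
    isotropicTriple⇐ (cells as) _ _ _ λ a b c nt →
      subst (T ∘ isotropic (cells as)) (reduce-combination as kx ky kz a b c)
        (isotropic-lift⇒ as _ _ (LiftsA-combination as ex ey ez a b c) (injective a b c nt) (isotropic-image a b c))
    where as = atoms D

  isotropicSubgroup⇐ : ∀ D → HasIsotropic3 (cells (atoms D)) → HasIsotropicZ2³ D
  isotropicSubgroup⇐ D (X , Y , Z , t) =
    lift as kx , lift as ky , lift as kz ,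
    lift⇒order2A as kx _ (LiftsA-lift as kx) , lift⇒order2A as ky _ (LiftsA-lift as ky) ,
    lift⇒order2A as kz _ (LiftsA-lift as kz) ,
    (λ a b c nt → proj₁ (image a b c nt)) , isotropic-image
    where
    as = atoms D
    kx = bits as X
    ky = bits as Y
    kz = bits as Z
    combination-lifts : ∀ a b c → LiftsA as (combinationA as a b c kx ky kz)
                                           (combinationA as a b c (lift as kx) (lift as ky) (lift as kz))
    combination-lifts = LiftsA-combination as (LiftsA-lift as kx) (LiftsA-lift as ky) (LiftsA-lift as kz)
    reduced : ∀ a b c → reduce as (combinationA as a b c kx ky kz) ≡ combination (cells as) a b c X Y Z
    reduced a b c = begin
      reduce as (combinationA as a b c kx ky kz)
        ≡⟨ reduce-combination as kx ky kz a b c ⟩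
      combination (cells as) a b c (reduce as kx) (reduce as ky) (reduce as kz)
        ≡⟨ cong₂ (λ p q → combination (cells as) a b c p q (reduce as kz)) (reduce-bits as X) (reduce-bits as Y) ⟩
      combination (cells as) a b c X Y (reduce as kz)
        ≡⟨ cong (combination (cells as) a b c X Y) (reduce-bits as Z) ⟩
      combination (cells as) a b c X Y Z ∎
      where open ≡-Reasoning
    image : ∀ a b c → NonTrivial a b c →
            (¬ EqA as (combinationA as a b c (lift as kx) (lift as ky) (lift as kz)) (zeroA as)) ×
            IsInt (qA as (combinationA as a b c (lift as kx) (lift as ky) (lift as kz)))
    image a b c nt = isotropic-lift⇐ as _ _ (combination-lifts a b c)
      (subst (T ∘ isotropic (cells as)) (sym (reduced a b c)) (isotropicTriple⇒ (cells as) X Y Z t a b c nt))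
    isotropic-image : ∀ a b c → IsInt (qA as (combinationA as a b c (lift as kx) (lift as ky) (lift as kz)))
    isotropic-image false false false =
      form≡0⇒integral as _ _ (combination-lifts false false false)
        (subst (λ n → T (n ℕ.% 4 ℕ.≡ᵇ 0))
          (sym (trans (cong (form (cells as)) (trans (reduced false false false) (combination-000 (cells as) X Y Z)))
                      (form-zero (cells as)))) tt)
    isotropic-image true  b     c     = proj₂ (image true b c λ ())
    isotropic-image false true  c     = proj₂ (image false true c λ ())
    isotropic-image false false true  = proj₂ (image false false true λ ())


module Rank where

  open import Defs
  open Cells using (dim)
  open Parity
  open TwoTorsion using (cells; divides⇒; ⇒divides; pow; pow-suc)
  open Tables using (boolLists)
  open TableFacts using (∈-boolLists; take-long)
  open Search using (all-∈)
  open import Data.Bool using (Bool; true; false; _∧_; _xor_; not; T)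
  open import Data.Bool.ListAction using (all)
  open import Data.Bool.Properties using (T-≡)
  open import Function.Bundles using (Equivalence; _⇔_; mk⇔)
  open import Data.Nat as ℕ using (ℕ; zero; suc; _≤_; _<_; z≤n; s≤s)
  open import Data.Nat.Properties using (≤-trans; <⇒≤; <⇒≱; ≰⇒>; _≤?_)
  open import Data.Integer as ℤ using (ℤ; +_; _+_; _*_; -_; _-_)
  open import Data.Integer.Properties as ℤ using ()
  open import Data.Integer.Tactic.RingSolver using (solve-∀)
  open import Data.Integer.Divisibility using () renaming (_∣_ to _∣ℤ_)
  open import Data.List using (List; []; _∷_; _++_; map; replicate; take; length; zipWith; upTo; tabulate)
  open import Data.List.Properties using (≡-dec; map-tabulate)
  open import Data.List.Membership.Propositional using (_∈_)
  open import Data.List.Membership.Propositional.Properties using (∈-++⁺ˡ; ∈-++⁺ʳ; ∈-++⁻; ∈-map⁺; ∈-map⁻; ∈-upTo⁻)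
  import Data.List.Relation.Unary.All as All
  open import Data.List.Relation.Unary.All.Properties using (all⁻)
  open import Data.Sum using (inj₁; inj₂)
  open import Data.List.Membership.DecPropositional (≡-dec Data.Bool._≟_) using (_∈?_)
  open import Data.List.Relation.Unary.Any using (here)
  open import Data.Fin as Fin using (Fin)
  open import Data.Product using (Σ-syntax; ∃-syntax; _,_; map₂)
  open import Data.Unit using (tt)
  open import Data.Empty using (⊥; ⊥-elim)
  open import Relation.Binary.PropositionalEquality
  open import Relation.Nullary using (¬_; yes; no)
  open import Relation.Nullary.Decidable using (fromWitness; isYes)
  open import Function using (_∘_)
  import Data.Bool

  dimA : List Atom → ℕ
  dimA as = dim (cells as)

  coordinates : (as : List Atom) → AElem as → List Bool
  coordinates []                    _              = []
  coordinates (atom j (cyc _) ∷ as) (x , xs)       = parity x ∷ coordinates as xs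
  coordinates (atom j blkU ∷ as)    ((x , y) , xs) = parity x ∷ parity y ∷ coordinates as xs
  coordinates (atom j blkV ∷ as)    ((x , y) , xs) = parity x ∷ parity y ∷ coordinates as xs

  length-coordinates : ∀ as x → length (coordinates as x) ≡ dimA as
  length-coordinates []                    _        = refl
  length-coordinates (atom j (cyc _) ∷ as) (_ , xs) = cong suc (length-coordinates as xs)
  length-coordinates (atom j blkU ∷ as)    (_ , xs) = cong (λ n → suc (suc n)) (length-coordinates as xs)
  length-coordinates (atom j blkV ∷ as)    (_ , xs) = cong (λ n → suc (suc n)) (length-coordinates as xs)

  coordinates-add : ∀ as x y → coordinates as (addA as x y) ≡ zipWith _xor_ (coordinates as x) (coordinates as y)
  coordinates-add []                    _              _              = refl
  coordinates-add (atom j (cyc _) ∷ as) (x , xs)       (y , ys)       =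
    cong₂ _∷_ (parity-+ x y) (coordinates-add as xs ys)
  coordinates-add (atom j blkU ∷ as)    ((x , x') , xs) ((y , y') , ys) =
    cong₂ _∷_ (parity-+ x y) (cong₂ _∷_ (parity-+ x' y') (coordinates-add as xs ys))
  coordinates-add (atom j blkV ∷ as)    ((x , x') , xs) ((y , y') , ys) =
    cong₂ _∷_ (parity-+ x y) (cong₂ _∷_ (parity-+ x' y') (coordinates-add as xs ys))

  coordinates-smul : ∀ as c x → coordinates as (smulA as c x) ≡ map (parity c ∧_) (coordinates as x)
  coordinates-smul []                    _ _               = refl
  coordinates-smul (atom j (cyc _) ∷ as) c (x , xs)        = cong₂ _∷_ (parity-* c x) (coordinates-smul as c xs)
  coordinates-smul (atom j blkU ∷ as)    c ((x , x') , xs) =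
    cong₂ _∷_ (parity-* c x) (cong₂ _∷_ (parity-* c x') (coordinates-smul as c xs))
  coordinates-smul (atom j blkV ∷ as)    c ((x , x') , xs) =
    cong₂ _∷_ (parity-* c x) (cong₂ _∷_ (parity-* c x') (coordinates-smul as c xs))

  coordinates-zero : ∀ as → coordinates as (zeroA as) ≡ replicate (dimA as) false
  coordinates-zero []                    = refl
  coordinates-zero (atom j (cyc _) ∷ as) = cong (false ∷_) (coordinates-zero as)
  coordinates-zero (atom j blkU ∷ as)    = cong (λ t → false ∷ false ∷ t) (coordinates-zero as)
  coordinates-zero (atom j blkV ∷ as)    = cong (λ t → false ∷ false ∷ t) (coordinates-zero as)

  private
    parity-congruent : ∀ j x y → (+ pow2 (suc j)) ∣ℤ (x - y) → parity x ≡ parity y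
    parity-congruent j x y d with divides⇒ {z = x - y} d
    ... | q , e = xor-zero (trans (sym (trans (parity-+ x (- y)) (cong (parity x xor_) (parity-neg y))))
                                  (trans (cong parity e) even-multiple))
      where
      xor-zero : ∀ {a b} → a xor b ≡ false → a ≡ b
      xor-zero {true}  {true}  _ = refl
      xor-zero {false} {false} _ = refl
      even-multiple : parity (q * + pow2 (suc j)) ≡ false
      even-multiple = trans (parity-* q (pow (suc j)))
        (trans (cong (λ p → parity q ∧ p) (trans (cong parity (pow-suc j)) (parity-* (+ 2) (pow j))))
               (∧-false (parity q)))
        where ∧-false : ∀ a → a ∧ false ≡ false
              ∧-false true  = refl
              ∧-false false = refl

  coordinates-resp : ∀ as x y → EqA as x y → coordinates as x ≡ coordinates as y
  coordinates-resp []                    _               _               _               = refl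
  coordinates-resp (atom j (cyc _) ∷ as) (x , xs)        (y , ys)        (d , ds)        =
    cong₂ _∷_ (parity-congruent j x y d) (coordinates-resp as xs ys ds)
  coordinates-resp (atom j blkU ∷ as)    ((x , x') , xs) ((y , y') , ys) ((d , d') , ds) =
    cong₂ _∷_ (parity-congruent j x y d) (cong₂ _∷_ (parity-congruent j x' y' d') (coordinates-resp as xs ys ds))
  coordinates-resp (atom j blkV ∷ as)    ((x , x') , xs) ((y , y') , ys) ((d , d') , ds) =
    cong₂ _∷_ (parity-congruent j x y d) (cong₂ _∷_ (parity-congruent j x' y' d') (coordinates-resp as xs ys ds))

  onehot : ℕ → ℕ → List Bool
  onehot zero    _       = []
  onehot (suc n) zero    = true ∷ replicate n false
  onehot (suc n) (suc t) = false ∷ onehot n t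

  unitA : (as : List Atom) → ℕ → AElem as
  unitA []                    _             = tt
  unitA (atom j (cyc _) ∷ as) zero          = + 1 , zeroA as
  unitA (atom j (cyc _) ∷ as) (suc t)       = + 0 , unitA as t
  unitA (atom j blkU ∷ as)    zero          = (+ 1 , + 0) , zeroA as
  unitA (atom j blkU ∷ as)    (suc zero)    = (+ 0 , + 1) , zeroA as
  unitA (atom j blkU ∷ as)    (suc (suc t)) = (+ 0 , + 0) , unitA as t
  unitA (atom j blkV ∷ as)    zero          = (+ 1 , + 0) , zeroA as
  unitA (atom j blkV ∷ as)    (suc zero)    = (+ 0 , + 1) , zeroA as
  unitA (atom j blkV ∷ as)    (suc (suc t)) = (+ 0 , + 0) , unitA as t

  coordinates-unit : ∀ as t → coordinates as (unitA as t) ≡ onehot (dimA as) t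
  coordinates-unit []                    _             = refl
  coordinates-unit (atom j (cyc _) ∷ as) zero          = cong (true ∷_) (coordinates-zero as)
  coordinates-unit (atom j (cyc _) ∷ as) (suc t)       = cong (false ∷_) (coordinates-unit as t)
  coordinates-unit (atom j blkU ∷ as)    zero          = cong (λ v → true ∷ false ∷ v) (coordinates-zero as)
  coordinates-unit (atom j blkU ∷ as)    (suc zero)    = cong (λ v → false ∷ true ∷ v) (coordinates-zero as)
  coordinates-unit (atom j blkU ∷ as)    (suc (suc t)) = cong (λ v → false ∷ false ∷ v) (coordinates-unit as t)
  coordinates-unit (atom j blkV ∷ as)    zero          = cong (λ v → true ∷ false ∷ v) (coordinates-zero as)
  coordinates-unit (atom j blkV ∷ as)    (suc zero)    = cong (λ v → false ∷ true ∷ v) (coordinates-zero as)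
  coordinates-unit (atom j blkV ∷ as)    (suc (suc t)) = cong (λ v → false ∷ false ∷ v) (coordinates-unit as t)

  span : ℕ → List (List Bool) → List (List Bool)
  span n []       = replicate n false ∷ []
  span n (g ∷ gs) = span n gs ++ map (zipWith _xor_ g) (span n gs)

  private
    zipWith-xor-false : ∀ v → zipWith _xor_ (replicate (length v) false) v ≡ v
    zipWith-xor-false []      = refl
    zipWith-xor-false (_ ∷ v) = cong (_ ∷_) (zipWith-xor-false v)

    map-true∧ : ∀ v → map (true ∧_) v ≡ v
    map-true∧ []      = refl
    map-true∧ (_ ∷ v) = cong (_ ∷_) (map-true∧ v)

    map-false∧ : ∀ v → map (false ∧_) v ≡ replicate (length v) false
    map-false∧ []      = refl
    map-false∧ (_ ∷ v) = cong (false ∷_) (map-false∧ v)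

  ∈-span-step : ∀ {n} g gs v p → length g ≡ n → length v ≡ n → v ∈ span n gs →
                zipWith _xor_ (map (p ∧_) g) v ∈ span n (g ∷ gs)
  ∈-span-step g gs v true  _  _  v∈ =
    subst (λ u → zipWith _xor_ u v ∈ span _ (g ∷ gs)) (sym (map-true∧ g)) (∈-++⁺ʳ _ (∈-map⁺ (zipWith _xor_ g) v∈))
  ∈-span-step g gs v false lg lv v∈ =
    subst (_∈ span _ (g ∷ gs)) (sym (trans (cong (λ u → zipWith _xor_ u v) (trans (map-false∧ g)
                                                    (cong (λ n → replicate n false) (trans lg (sym lv)))))
                                          (zipWith-xor-false v)))
          (∈-++⁺ˡ v∈)

  lincombA : (as : List Atom) (r : ℕ) → (Fin r → ℤ) → (Fin r → AElem as) → AElem as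
  lincombA as zero    c g = zeroA as
  lincombA as (suc r) c g = addA as (smulA as (c Fin.zero) (g Fin.zero)) (lincombA as r (c ∘ Fin.suc) (g ∘ Fin.suc))

  lincomb≡lincombA : ∀ D r c g → lincomb D r c g ≡ lincombA (atoms D) r c g
  lincomb≡lincombA D zero    c g = refl
  lincomb≡lincombA D (suc r) c g =
    cong (addA (atoms D) (smulA (atoms D) (c Fin.zero) (g Fin.zero))) (lincomb≡lincombA D r (c ∘ Fin.suc) (g ∘ Fin.suc))

  GeneratesA : (as : List Atom) (r : ℕ) → (Fin r → AElem as) → Set
  GeneratesA as r g = ∀ y → ∃[ c ] EqA as y (lincombA as r c g)

  Generates⇔GeneratesA : ∀ D r g → Generates D r g ⇔ GeneratesA (atoms D) r g
  Generates⇔GeneratesA D r g = mk⇔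
    (λ gen y → map₂ (λ {c} → subst (EqA (atoms D) y) (lincomb≡lincombA D r c g)) (gen y))
    (λ gen y → map₂ (λ {c} → subst (EqA (atoms D) y) (sym (lincomb≡lincombA D r c g))) (gen y))

  coordinates-lincomb : ∀ as r c g → coordinates as (lincombA as r c g) ∈ span (dimA as) (tabulate (coordinates as ∘ g))
  coordinates-lincomb as zero    c g = here (coordinates-zero as)
  coordinates-lincomb as (suc r) c g =
    subst (_∈ span (dimA as) (tabulate (coordinates as ∘ g)))
          (sym (trans (coordinates-add as (smulA as (c Fin.zero) (g Fin.zero)) rest)
                      (cong (λ u → zipWith _xor_ u (coordinates as rest)) (coordinates-smul as (c Fin.zero) (g Fin.zero)))))
          (∈-span-step _ (tabulate (coordinates as ∘ g ∘ Fin.suc)) _ (parity (c Fin.zero))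
                       (length-coordinates as (g Fin.zero)) (length-coordinates as rest)
                       (coordinates-lincomb as r (c ∘ Fin.suc) (g ∘ Fin.suc)))
    where rest = lincombA as r (c ∘ Fin.suc) (g ∘ Fin.suc)

  private
    take-replicate : ∀ {A : Set} {k n} (x : A) → k ≤ n → take k (replicate n x) ≡ replicate k x
    take-replicate {k = zero}  _ _         = refl
    take-replicate {k = suc k} x (s≤s k≤n) = cong (x ∷_) (take-replicate x k≤n)

    take-zipWith : ∀ k u v → take k (zipWith _xor_ u v) ≡ zipWith _xor_ (take k u) (take k v)
    take-zipWith zero    _       _       = refl
    take-zipWith (suc k) []      _       = refl
    take-zipWith (suc k) (_ ∷ _) []      = refl
    take-zipWith (suc k) (a ∷ u) (b ∷ v) = cong ((a xor b) ∷_) (take-zipWith k u v)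

    take-onehot : ∀ {k n} t → k ≤ n → take k (onehot n t) ≡ onehot k t
    take-onehot {zero}              _       _         = refl
    take-onehot {suc k} {suc n} zero    (s≤s k≤n) = cong (true ∷_) (take-replicate false k≤n)
    take-onehot {suc k} {suc n} (suc t) (s≤s k≤n) = cong (false ∷_) (take-onehot t k≤n)

  take-∈-span : ∀ {k n} → k ≤ n → ∀ gs {v} → v ∈ span n gs → take k v ∈ span k (map (take k) gs)
  take-∈-span k≤n []       (here refl) = here (take-replicate false k≤n)
  take-∈-span {k} {n} k≤n (g ∷ gs) v∈ with ∈-++⁻ (span n gs) v∈
  ... | inj₁ v∈gs = ∈-++⁺ˡ (take-∈-span k≤n gs v∈gs)
  ... | inj₂ v∈g+gs with ∈-map⁻ (zipWith _xor_ g) v∈g+gs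
  ...   | u , u∈gs , refl =
    ∈-++⁺ʳ _ (subst (_∈ map (zipWith _xor_ (take k g)) (span k (map (take k) gs))) (sym (take-zipWith k g u))
                    (∈-map⁺ (zipWith _xor_ (take k g)) (take-∈-span k≤n gs u∈gs)))

  spansUnits : ℕ → List (List Bool) → Bool
  spansUnits k gs = all (λ t → isYes (onehot k t ∈? span k gs)) (upTo k)

  spansUnits-complete : ∀ k gs → (∀ t → t < k → onehot k t ∈ span k gs) → T (spansUnits k gs)
  spansUnits-complete k gs units =
    all⁻ (λ t → isYes (onehot k t ∈? span k gs)) (All.tabulate (λ {t} t∈ → fromWitness {a? = onehot k t ∈? span k gs} (units t (∈-upTo⁻ t∈))))

  -- r vectors of 𝔽₂^(r+1) do not span it, checked for r ≤ 2.
  fewVectorsDoNotSpan : ℕ → Bool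
  fewVectorsDoNotSpan 0 = not (spansUnits 1 [])
  fewVectorsDoNotSpan 1 = all (λ G → not (spansUnits 2 (G ∷ []))) (boolLists 2)
  fewVectorsDoNotSpan 2 = all (λ G → all (λ H → not (spansUnits 3 (G ∷ H ∷ []))) (boolLists 3)) (boolLists 3)
  fewVectorsDoNotSpan _ = false

  fewVectorsDoNotSpan-ok : ∀ r → r ≤ 2 → fewVectorsDoNotSpan r ≡ true
  fewVectorsDoNotSpan-ok 0 _ = refl
  fewVectorsDoNotSpan-ok 1 _ = refl
  fewVectorsDoNotSpan-ok 2 _ = refl
  fewVectorsDoNotSpan-ok (suc (suc (suc _))) (s≤s (s≤s ()))

  private
    refute : ∀ {b} → T (not b) → T b → ⊥
    refute {true} ()

    T-ok : ∀ {b} → b ≡ true → T b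
    T-ok = Equivalence.from T-≡

  few-vectors-do-not-span : ∀ r → r ≤ 2 → (G : Fin r → List Bool) → (∀ i → G i ∈ boolLists (suc r)) →
                            ¬ T (spansUnits (suc r) (tabulate G))
  few-vectors-do-not-span 0 _ G _ = refute (T-ok (fewVectorsDoNotSpan-ok 0 z≤n))
  few-vectors-do-not-span 1 _ G G∈ =
    refute (all-∈ (λ G → not (spansUnits 2 (G ∷ []))) (T-ok (fewVectorsDoNotSpan-ok 1 (s≤s z≤n))) (G∈ Fin.zero))
  few-vectors-do-not-span 2 _ G G∈ =
    refute (all-∈ (λ H → not (spansUnits 3 (G Fin.zero ∷ H ∷ [])))
             (all-∈ (λ G → all (λ H → not (spansUnits 3 (G ∷ H ∷ []))) (boolLists 3))
                    (T-ok (fewVectorsDoNotSpan-ok 2 (s≤s (s≤s z≤n)))) (G∈ Fin.zero))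
             (G∈ (Fin.suc Fin.zero)))
  few-vectors-do-not-span (suc (suc (suc _))) (s≤s (s≤s ()))

  generators-bound : ∀ as r g → GeneratesA as r g → r ≤ 2 → dimA as ≤ r
  generators-bound as r g gen r≤2 with dimA as ≤? r
  ... | yes d≤r = d≤r
  ... | no  d≰r = ⊥-elim (few-vectors-do-not-span r r≤2 prefix prefix∈ (spansUnits-complete (suc r) (tabulate prefix) units))
    where
    r<d = ≰⇒> d≰r
    prefix : Fin r → List Bool
    prefix = take (suc r) ∘ coordinates as ∘ g
    generatorCoordinates = tabulate (coordinates as ∘ g)
    units : ∀ t → t < suc r → onehot (suc r) t ∈ span (suc r) (tabulate prefix)
    units t _ with gen (unitA as t)
    ... | c , unit≈ =
      subst₂ (λ u gs → u ∈ span (suc r) gs) (take-onehot t r<d) (map-tabulate (coordinates as ∘ g) (take (suc r)))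
        (take-∈-span r<d generatorCoordinates
          (subst (_∈ span (dimA as) generatorCoordinates)
                 (trans (sym (coordinates-resp as _ _ unit≈)) (coordinates-unit as t))
                 (coordinates-lincomb as r c g)))
    prefix∈ : ∀ i → prefix i ∈ boolLists (suc r)
    prefix∈ i = subst (λ n → prefix i ∈ boolLists n)
                      (take-long (suc r) (coordinates as (g i)) (subst (suc r ≤_) (sym (length-coordinates as (g i))) r<d))
                      (∈-boolLists (prefix i))

  private
    ≡⇒congruent : ∀ j {a b} → a ≡ b → (+ pow2 (suc j)) ∣ℤ (a - b)
    ≡⇒congruent j {a} refl = ⇒divides (+ 0) (trans (ℤ.+-inverseʳ a) (sym (ℤ.*-zeroˡ (+ pow2 (suc j)))))

    one-coordinate : ∀ y → y ≡ y * + 1 + + 0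
    one-coordinate = solve-∀
    first-of-two : ∀ y w → y ≡ y * + 1 + (w * + 0 + + 0)
    first-of-two = solve-∀
    second-of-two : ∀ y w → w ≡ y * + 0 + (w * + 1 + + 0)
    second-of-two = solve-∀

  small-generators : ∀ as → dimA as ≤ 2 → Σ[ g ∈ (Fin (dimA as) → AElem as) ] GeneratesA as (dimA as) g
  small-generators [] _ = (λ ()) , λ _ → (λ ()) , tt
  small-generators (atom j (cyc _) ∷ []) _ =
    (λ _ → + 1 , tt) , λ { (y , tt) → (λ _ → y) , ≡⇒congruent j (one-coordinate y) , tt }
  small-generators (atom j (cyc _) ∷ atom j' (cyc _) ∷ []) _ =
    (λ { Fin.zero → + 1 , + 0 , tt ; (Fin.suc _) → + 0 , + 1 , tt }) ,
    λ { (y , w , tt) → (λ { Fin.zero → y ; (Fin.suc _) → w }) ,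
                       ≡⇒congruent j (first-of-two y w) , ≡⇒congruent j' (second-of-two y w) , tt }
  small-generators (atom j blkU ∷ []) _ =
    (λ { Fin.zero → (+ 1 , + 0) , tt ; (Fin.suc _) → (+ 0 , + 1) , tt }) ,
    λ { ((y , w) , tt) → (λ { Fin.zero → y ; (Fin.suc _) → w }) ,
                         (≡⇒congruent j (first-of-two y w) , ≡⇒congruent j (second-of-two y w)) , tt }
  small-generators (atom j blkV ∷ []) _ =
    (λ { Fin.zero → (+ 1 , + 0) , tt ; (Fin.suc _) → (+ 0 , + 1) , tt }) ,
    λ { ((y , w) , tt) → (λ { Fin.zero → y ; (Fin.suc _) → w }) ,
                         (≡⇒congruent j (first-of-two y w) , ≡⇒congruent j (second-of-two y w)) , tt }
  small-generators (atom _ (cyc _) ∷ atom _ (cyc _) ∷ atom _ (cyc _) ∷ _) (s≤s (s≤s ()))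
  small-generators (atom _ (cyc _) ∷ atom _ (cyc _) ∷ atom _ blkU    ∷ _) (s≤s (s≤s ()))
  small-generators (atom _ (cyc _) ∷ atom _ (cyc _) ∷ atom _ blkV    ∷ _) (s≤s (s≤s ()))
  small-generators (atom _ (cyc _) ∷ atom _ blkU    ∷ _) (s≤s (s≤s ()))
  small-generators (atom _ (cyc _) ∷ atom _ blkV    ∷ _) (s≤s (s≤s ()))
  small-generators (atom _ blkU    ∷ atom _ (cyc _) ∷ _) (s≤s (s≤s ()))
  small-generators (atom _ blkU    ∷ atom _ blkU    ∷ _) (s≤s (s≤s ()))
  small-generators (atom _ blkU    ∷ atom _ blkV    ∷ _) (s≤s (s≤s ()))
  small-generators (atom _ blkV    ∷ atom _ (cyc _) ∷ _) (s≤s (s≤s ()))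
  small-generators (atom _ blkV    ∷ atom _ blkU    ∷ _) (s≤s (s≤s ()))
  small-generators (atom _ blkV    ∷ atom _ blkV    ∷ _) (s≤s (s≤s ()))

  rank≤2⇒dim≤rank : ∀ B r → HasRank B r → r < 3 → dimA (atoms B) ≤ r
  rank≤2⇒dim≤rank B r ((g , gen) , _) (s≤s r≤2) =
    generators-bound (atoms B) r g (Equivalence.to (Generates⇔GeneratesA B r g) gen) r≤2

  dim≤2⇒rank≡dim : ∀ B → dimA (atoms B) ≤ 2 → HasRank B (dimA (atoms B))
  dim≤2⇒rank≡dim B d≤2 with small-generators (atoms B) d≤2
  ... | g , gen = (g , Equivalence.from (Generates⇔GeneratesA B _ g) gen) , λ r' r'<d (g' , gen') →
    <⇒≱ r'<d (generators-bound (atoms B) r' g' (Equivalence.to (Generates⇔GeneratesA B r' g') gen')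
                               (≤-trans (<⇒≤ r'<d) d≤2))


module Membership where

  open import Defs
  open Tables using (count₁; count₃; signedOddity; inD'ᵒ; inD'ᵉ; e∈35; e∈26; _==_; minusSign)
  open TwoTorsion using (residue)
  open Search using (all-∈)
  open import Data.Bool using (Bool; true; false; not; _∧_; _∨_; T)
  import Data.Bool
  open import Data.Bool.ListAction using (all)
  open import Data.Bool.Properties using (T-≡; T-∨; T-∧)
  open import Data.Nat as ℕ using (ℕ; zero; suc; _+_; _*_; _%_; _/_; _<_; _≤_; _≤ᵇ_; z≤n; s≤s)
  open import Data.Nat.Properties as ℕ using (≤ᵇ⇒≤; ≤⇒≤ᵇ)
  open import Data.Nat.DivMod using (m%n<n; %-distribˡ-+; [m+n]%n≡m%n; m*n/n≡m)
  open import Data.Integer as ℤ using (ℤ)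
  open import Data.Sign as Sign using (Sign)
  open import Data.List using (List; []; _∷_; map; length; upTo)
  open import Data.List.Properties using (length-map)
  open import Data.List.Membership.Propositional.Properties using (∈-upTo⁺)
  open import Data.Product using (_×_; _,_; proj₁)
  open import Data.Sum using (inj₁; inj₂)
  open import Data.Unit using (⊤; tt)
  open import Data.Empty using (⊥-elim)
  open import Function.Bundles using (Equivalence; _⇔_; mk⇔)
  open import Relation.Binary.PropositionalEquality
  open import Relation.Nullary using (¬_; Dec; yes; no)
  open import Relation.Nullary.Decidable using (isYes; toWitness; fromWitness)
  open import Function using (_∘′_)

  -- The invariant ε e(t/8) = e(k/8) of the symbol q_t^ε, as k ∈ ℤ/8.
  invariant : Sign → ℕ → ℕ
  invariant Sign.+ t = t % 8
  invariant Sign.- t = (t + 4) % 8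

  private
    T-ok : ∀ {b} → b ≡ true → T b
    T-ok = Equivalence.from T-≡

    lit : ∀ {m n} → T (m ≤ᵇ n) → m ≤ n
    lit {m} {n} = ≤ᵇ⇒≤ m n

  by-evaluation : ∀ {P : ℕ → Set} (P? : ∀ t → Dec (P t)) n → all (λ t → isYes (P? t)) (upTo n) ≡ true → ∀ {t} → t < n → P t
  by-evaluation P? n ok t<n = toWitness (all-∈ (λ t → isYes (P? t)) (T-ok ok) (∈-upTo⁺ t<n))

  by-evaluation₂ : ∀ {P : ℕ → ℕ → Set} (P? : ∀ r t → Dec (P r t)) a b →
                   all (λ r → all (λ t → isYes (P? r t)) (upTo b)) (upTo a) ≡ true → ∀ {r t} → r < a → t < b → P r t
  by-evaluation₂ P? a b ok {r} r<a =
    by-evaluation (P? r) b (Equivalence.to T-≡ (all-∈ (λ r → all (λ t → isYes (P? r t)) (upTo b)) (T-ok ok) (∈-upTo⁺ r<a)))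

  weight : Bool → ℕ
  weight true  = 1
  weight false = 7

  signedOddity-∷ : ∀ b bs → signedOddity (b ∷ bs) ≡ (weight b + signedOddity bs) % 8
  signedOddity-∷ true  bs = %-distribˡ-+ 1 (count₁ bs + 7 * count₃ bs) 8
  signedOddity-∷ false bs = trans (cong (_% 8) (lemma (count₁ bs) (count₃ bs))) (%-distribˡ-+ 7 (count₁ bs + 7 * count₃ bs) 8)
    where
    lemma : ∀ a b → a + 7 * suc b ≡ 7 + (a + 7 * b)
    lemma a b = trans (cong (a +_) (ℕ.*-suc 7 b))
                      (trans (sym (ℕ.+-assoc a 7 (7 * b))) (trans (cong (_+ 7 * b) (ℕ.+-comm a 7)) (ℕ.+-assoc 7 a (7 * b))))

  kron2u≡kron2u%8 : ∀ u → kron2u u ≡ kron2u (u % 8)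
  kron2u≡kron2u%8 u with u % 8 | m%n<n u 8
  ... | 0 | _ = refl
  ... | 1 | _ = refl
  ... | 2 | _ = refl
  ... | 3 | _ = refl
  ... | 4 | _ = refl
  ... | 5 | _ = refl
  ... | 6 | _ = refl
  ... | 7 | _ = refl
  ... | suc (suc (suc (suc (suc (suc (suc (suc _))))))) | s≤s (s≤s (s≤s (s≤s (s≤s (s≤s (s≤s (s≤s ())))))))

  private
    %4-step : ∀ m → (4 + m) % 4 ≡ m % 4
    %4-step m = trans (cong (_% 4) (ℕ.+-comm 4 m)) ([m+n]%n≡m%n m 4)

  residue%4 : ∀ m → residue m ≡ residue (m % 4)
  residue%4 0 = refl
  residue%4 1 = refl
  residue%4 2 = refl
  residue%4 3 = refl
  residue%4 (suc (suc (suc (suc m)))) = trans (residue%4 m) (cong residue (sym (%4-step m)))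

  odd%8 : ∀ m → suc (2 * m) % 8 ≡ suc (2 * (m % 4))
  odd%8 0 = refl
  odd%8 1 = refl
  odd%8 2 = refl
  odd%8 3 = refl
  odd%8 (suc (suc (suc (suc m)))) =
    trans (cong (_% 8) (lemma m)) (trans ([m+n]%n≡m%n (suc (2 * m)) 8) (trans (odd%8 m) (cong (λ x → suc (2 * x)) (sym (%4-step m)))))
    where
    lemma : ∀ m → suc (2 * (4 + m)) ≡ suc (2 * m) + 8
    lemma m = cong suc (trans (ℕ.*-distribˡ-+ 2 4 m) (ℕ.+-comm 8 (2 * m)))

  oddity-∷ : ∀ m ms → oddity (m ∷ ms) ≡ (suc (2 * m) % 8 + oddity ms) % 8
  oddity-∷ m ms = %-distribˡ-+ (suc (2 * m)) _ 8

  oddity<8 : ∀ ms → oddity ms < 8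
  oddity<8 []       = s≤s z≤n
  oddity<8 (m ∷ ms) = subst (_< 8) (sym (oddity-∷ m ms)) (m%n<n (suc (2 * m) % 8 + oddity ms) 8)

  -- One more odd cyclic summand ⟨u/2q⟩ adds weight(u mod 4) to the invariant.
  invariant-step : ∀ ε r t → r < 4 → t < 8 →
    invariant (kron2u (suc (2 * r)) Sign.* ε) ((suc (2 * r) + t) % 8) ≡ (weight (residue r) + invariant ε t) % 8
  invariant-step ε r t = by-evaluation₂ (step? ε) 4 8 (checked ε)
    where
    step? : ∀ ε r t → Dec (invariant (kron2u (suc (2 * r)) Sign.* ε) ((suc (2 * r) + t) % 8)
                           ≡ (weight (residue r) + invariant ε t) % 8)
    step? ε r t = _ ℕ.≟ _
    checked : ∀ ε → all (λ r → all (λ t → isYes (step? ε r t)) (upTo 8)) (upTo 4) ≡ true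
    checked Sign.+ = refl
    checked Sign.- = refl

  invariant-oddity : ∀ ms → invariant (oddSign ms) (oddity ms) ≡ signedOddity (map residue ms)
  invariant-oddity []       = refl
  invariant-oddity (m ∷ ms) = begin
    invariant (oddSign (m ∷ ms)) (oddity (m ∷ ms))
      ≡⟨ cong₂ (λ s t → invariant (s Sign.* oddSign ms) t) (trans (kron2u≡kron2u%8 u) (cong kron2u (odd%8 m)))
               (trans (oddity-∷ m ms) (cong (λ x → (x + oddity ms) % 8) (odd%8 m))) ⟩
    invariant (kron2u (suc (2 * r)) Sign.* oddSign ms) ((suc (2 * r) + oddity ms) % 8)
      ≡⟨ invariant-step (oddSign ms) r (oddity ms) (m%n<n m 4) (oddity<8 ms) ⟩
    (weight (residue r) + invariant (oddSign ms) (oddity ms)) % 8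
      ≡⟨ cong₂ (λ b x → (weight b + x) % 8) (sym (residue%4 m)) (invariant-oddity ms) ⟩
    (weight (residue m) + signedOddity (map residue ms)) % 8
      ≡⟨ sym (signedOddity-∷ (residue m) (map residue ms)) ⟩
    signedOddity (map residue (m ∷ ms)) ∎
    where
    open ≡-Reasoning
    u = suc (2 * m)
    r = m % 4

  reflects : ∀ {A : Set} (A? : Dec A) {b} → isYes A? ≡ b → A ⇔ T b
  reflects A? refl = mk⇔ fromWitness toWitness

  invariant≡0⇔ : ∀ ε t → εe8≡1 ε t ⇔ invariant ε t ≡ 0
  invariant≡0⇔ Sign.+ t = mk⇔ (λ e → e) (λ e → e)
  invariant≡0⇔ Sign.- t = mk⇔ (λ e → e) (λ e → e)

  kronecker⇔ : ∀ ε t → t < 8 → εkron≡-1 ε t ⇔ T (e∈35 (invariant ε t))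
  kronecker⇔ ε t t<8 = reflects (kron? ε t) (by-evaluation (λ t → isYes (kron? ε t) Data.Bool.≟ e∈35 (invariant ε t)) 8 (checked ε) t<8)
    where
    kron? : ∀ ε t → Dec (εkron≡-1 ε t)
    kron? ε t = (ε ℤ.◃ 1) ℤ.* kron2 t ℤ.≟ ℤ.-[1+ 0 ]
    checked : ∀ ε → all (λ t → isYes (isYes (kron? ε t) Data.Bool.≟ e∈35 (invariant ε t))) (upTo 8) ≡ true
    checked Sign.+ = refl
    checked Sign.- = refl

  oddity%4⇔ : ∀ ε t → t < 8 → t % 4 ≡ 2 ⇔ T (e∈26 (invariant ε t))
  oddity%4⇔ ε t t<8 = reflects (t % 4 ℕ.≟ 2) (by-evaluation (λ t → isYes (t % 4 ℕ.≟ 2) Data.Bool.≟ e∈26 (invariant ε t)) 8 (checked ε) t<8)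
    where
    checked : ∀ ε → all (λ t → isYes (isYes (t % 4 ℕ.≟ 2) Data.Bool.≟ e∈26 (invariant ε t))) (upTo 8) ≡ true
    checked Sign.+ = refl
    checked Sign.- = refl

  oddPart : ℕ → Sign → ℕ → Part2
  oddPart zero    _ _ = none2
  oddPart (suc n) ε t = odd2 ε (suc n) t

  scale4Part : ℕ → Sign → ℕ → Part4
  scale4Part zero    _ _ = none4
  scale4Part (suc m) δ s = odd4 δ (suc m) s

  sign : Bool → Sign
  sign true  = Sign.-
  sign false = Sign.+

  isMinus : Sign → Bool
  isMinus Sign.- = true
  isMinus Sign.+ = false

  rank₄ : Part4 → ℕ
  rank₄ none4          = 0
  rank₄ (odd4 _ m _) = m

  inD : ℕ → Part2 → Part4 → Bool
  inD k none2        P4 = inD'ᵒ k 0 0 (rank₄ P4)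
  inD k (odd2 ε n t) P4 = inD'ᵒ k n (invariant ε t) (rank₄ P4)
  inD k (even2 ε n)  P4 = inD'ᵉ k (n / 2) (isMinus ε) (rank₄ P4)

  OddityReduced : Part2 → Set
  OddityReduced (odd2 _ _ t) = t < 8
  OddityReduced _            = ⊤

  private
    ∨-introˡ : ∀ {a b} → T a → T (a ∨ b)
    ∨-introˡ p = Equivalence.from T-∨ (inj₁ p)

    infixr 4 _,ᵀ_
    _,ᵀ_ : ∀ {a b} → T a → T b → T (a ∧ b)
    p ,ᵀ q = Equivalence.from T-∧ (p , q)

    ≤ᵇ! : ∀ {m n} → m ≤ n → T (m ≤ᵇ n)
    ≤ᵇ! = ≤⇒≤ᵇ

    ≢0 : ∀ ε t → ¬ εe8≡1 ε t → T (not (invariant ε t == 0))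
    ≢0 ε t ne with invariant ε t ℕ.≟ 0
    ... | yes e = ⊥-elim (ne (Equivalence.from (invariant≡0⇔ ε t) e))
    ... | no ¬e = subst (T ∘′ not) (sym (≢⇒≡ᵇfalse ¬e)) tt
      where
      ≢⇒≡ᵇfalse : ∀ {e} → ¬ e ≡ 0 → (e == 0) ≡ false
      ≢⇒≡ᵇfalse {zero}  ¬e = ⊥-elim (¬e refl)
      ≢⇒≡ᵇfalse {suc _} _  = refl

  D'⇒inD : ∀ k {P2 P4} → D' k P2 P4 → OddityReduced P2 → T (inD k P2 P4)
  D'⇒inD 1 z          _ = _
  D'⇒inD 1 IIm2       _ = _
  D'⇒inD 1 o1         _ = _
  D'⇒inD 1 (o2 {ε} {t} c)  t<8 = ∨-introˡ (Equivalence.to (oddity%4⇔ ε t t<8) c) ,ᵀ _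
  D'⇒inD 1 (o3 {ε} {t} c)  t<8 = Equivalence.to (kronecker⇔ ε t t<8) c ,ᵀ _
  D'⇒inD 1 f1         _ = _
  D'⇒inD 1 o1f1       _ = _
  D'⇒inD 2 z          _ = _
  D'⇒inD 2 II2        _ = _
  D'⇒inD 2 IIm4       _ = _
  D'⇒inD 2 (on _ n≤3) _ = ≤ᵇ! (ℕ.≤-trans n≤3 (lit _)) ,ᵀ ∨-introˡ (≤ᵇ! n≤3) ,ᵀ _
  D'⇒inD 2 (o4 {ε} {t} ne) _ = ∨-introˡ (≢0 ε t ne) ,ᵀ _
  D'⇒inD 2 (o5 {ε} {t} c)  t<8 = ∨-introˡ (Equivalence.to (kronecker⇔ ε t t<8) c) ,ᵀ _
  D'⇒inD 2 f1         _ = _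
  D'⇒inD 2 II2f1      _ = _
  D'⇒inD 2 (onf1 _ n≤3) _ = ≤ᵇ! (ℕ.≤-trans n≤3 (lit _)) ,ᵀ ∨-introˡ (≤ᵇ! n≤3) ,ᵀ _
  D'⇒inD 2 f2         _ = _
  D'⇒inD 2 o1f2       _ = _
  D'⇒inD 3 z          _ = _
  D'⇒inD 3 II2        _ = _
  D'⇒inD 3 II4        _ = _
  D'⇒inD 3 IIm6       _ = _
  D'⇒inD 3 (on _ n≤5) _ = ≤ᵇ! (ℕ.≤-trans n≤5 (lit _)) ,ᵀ ∨-introˡ (≤ᵇ! n≤5) ,ᵀ _
  D'⇒inD 3 (o6 {ε} {t} ne) _ = ∨-introˡ (≢0 ε t ne) ,ᵀ _
  D'⇒inD 3 (o7 {ε} {t} c)  t<8 = ∨-introˡ (Equivalence.to (kronecker⇔ ε t t<8) c) ,ᵀ _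
  D'⇒inD 3 f1         _ = _
  D'⇒inD 3 II2f1      _ = _
  D'⇒inD 3 II4f1      _ = _
  D'⇒inD 3 (onf1 _ n≤5) _ = ≤ᵇ! (ℕ.≤-trans n≤5 (lit _)) ,ᵀ ∨-introˡ (≤ᵇ! n≤5) ,ᵀ _
  D'⇒inD 3 f2         _ = _
  D'⇒inD 3 II2f2      _ = _
  D'⇒inD 3 (onf2 _ n≤3) _ = ≤ᵇ! (ℕ.≤-trans n≤3 (lit _)) ,ᵀ ∨-introˡ (≤ᵇ! n≤3 ,ᵀ _) ,ᵀ _
  D'⇒inD 3 f3         _ = _
  D'⇒inD 3 o1f3       _ = _

  private
    split : ∀ {a b} → T (a ∧ b) → T a × T b
    split {a} = Equivalence.to (T-∧ {a})

    ∨-false-elim : ∀ {a} → T (a ∨ false) → T a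
    ∨-false-elim {true} _ = tt

    nonzero : ∀ ε t → T (not (invariant ε t == 0)) → ¬ εe8≡1 ε t
    nonzero ε t p e≡1 with invariant ε t | Equivalence.to (invariant≡0⇔ ε t) e≡1
    nonzero ε t () e≡1 | .0 | refl

  inD'ᵒ⇒D' : ∀ {k} → 1 ≤ k → k ≤ 3 → ∀ n ε t m δ σ → t < 8 → T (inD'ᵒ k n (invariant ε t) m) → D' k (oddPart n ε t) (scale4Part m δ σ)
  inD'ᵒ⇒D' {1} _ _ 0 _ _ 0 _ _ _ _ = z
  inD'ᵒ⇒D' {1} _ _ 0 _ _ 1 _ _ _ _ = f1
  inD'ᵒ⇒D' {1} _ _ 0 _ _ (suc (suc _)) _ _ _ ()
  inD'ᵒ⇒D' {1} _ _ 1 _ _ 0 _ _ _ _ = o1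
  inD'ᵒ⇒D' {1} _ _ 1 _ _ 1 _ _ _ _ = o1f1
  inD'ᵒ⇒D' {1} _ _ 1 _ _ (suc (suc _)) _ _ _ ()
  inD'ᵒ⇒D' {1} _ _ 2 ε t 0 _ _ t<8 p = o2 (Equivalence.from (oddity%4⇔ ε t t<8) (∨-false-elim (proj₁ (split p))))
  inD'ᵒ⇒D' {1} _ _ 2 _ _ 1 _ _ _ ()
  inD'ᵒ⇒D' {1} _ _ 2 _ _ (suc (suc _)) _ _ _ ()
  inD'ᵒ⇒D' {1} _ _ 3 ε t 0 _ _ t<8 p = o3 (Equivalence.from (kronecker⇔ ε t t<8) (proj₁ (split p)))
  inD'ᵒ⇒D' {1} _ _ 3 _ _ 1 _ _ _ ()
  inD'ᵒ⇒D' {1} _ _ 3 _ _ (suc (suc _)) _ _ _ ()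
  inD'ᵒ⇒D' {1} _ _ (suc (suc (suc (suc _)))) _ _ _ _ _ _ ()
  inD'ᵒ⇒D' {2} _ _ 0 _ _ 0 _ _ _ _ = z
  inD'ᵒ⇒D' {2} _ _ 0 _ _ 1 _ _ _ _ = f1
  inD'ᵒ⇒D' {2} _ _ 0 _ _ 2 _ _ _ _ = f2
  inD'ᵒ⇒D' {2} _ _ 0 _ _ (suc (suc (suc _))) _ _ _ ()
  inD'ᵒ⇒D' {2} _ _ 1 _ _ 0 _ _ _ _ = on (lit _) (lit _)
  inD'ᵒ⇒D' {2} _ _ 1 _ _ 1 _ _ _ _ = onf1 (lit _) (lit _)
  inD'ᵒ⇒D' {2} _ _ 1 _ _ 2 _ _ _ _ = o1f2
  inD'ᵒ⇒D' {2} _ _ 1 _ _ (suc (suc (suc _))) _ _ _ ()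
  inD'ᵒ⇒D' {2} _ _ 2 _ _ 0 _ _ _ _ = on (lit _) (lit _)
  inD'ᵒ⇒D' {2} _ _ 2 _ _ 1 _ _ _ _ = onf1 (lit _) (lit _)
  inD'ᵒ⇒D' {2} _ _ 2 _ _ (suc (suc _)) _ _ _ ()
  inD'ᵒ⇒D' {2} _ _ 3 _ _ 0 _ _ _ _ = on (lit _) (lit _)
  inD'ᵒ⇒D' {2} _ _ 3 _ _ 1 _ _ _ _ = onf1 (lit _) (lit _)
  inD'ᵒ⇒D' {2} _ _ 3 _ _ (suc (suc _)) _ _ _ ()
  inD'ᵒ⇒D' {2} _ _ 4 ε t 0 _ _ _ p = o4 (nonzero ε t (∨-false-elim (proj₁ (split p))))
  inD'ᵒ⇒D' {2} _ _ 4 _ _ 1 _ _ _ ()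
  inD'ᵒ⇒D' {2} _ _ 4 _ _ (suc (suc _)) _ _ _ ()
  inD'ᵒ⇒D' {2} _ _ 5 ε t 0 _ _ t<8 p = o5 (Equivalence.from (kronecker⇔ ε t t<8) (∨-false-elim (proj₁ (split p))))
  inD'ᵒ⇒D' {2} _ _ 5 _ _ 1 _ _ _ ()
  inD'ᵒ⇒D' {2} _ _ 5 _ _ (suc (suc _)) _ _ _ ()
  inD'ᵒ⇒D' {2} _ _ (suc (suc (suc (suc (suc (suc _)))))) _ _ _ _ _ _ ()
  inD'ᵒ⇒D' {3} _ _ 0 _ _ 0 _ _ _ _ = z
  inD'ᵒ⇒D' {3} _ _ 0 _ _ 1 _ _ _ _ = f1
  inD'ᵒ⇒D' {3} _ _ 0 _ _ 2 _ _ _ _ = f2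
  inD'ᵒ⇒D' {3} _ _ 0 _ _ 3 _ _ _ _ = f3
  inD'ᵒ⇒D' {3} _ _ 0 _ _ (suc (suc (suc (suc _)))) _ _ _ ()
  inD'ᵒ⇒D' {3} _ _ 1 _ _ 0 _ _ _ _ = on (lit _) (lit _)
  inD'ᵒ⇒D' {3} _ _ 1 _ _ 1 _ _ _ _ = onf1 (lit _) (lit _)
  inD'ᵒ⇒D' {3} _ _ 1 _ _ 2 _ _ _ _ = onf2 (lit _) (lit _)
  inD'ᵒ⇒D' {3} _ _ 1 _ _ 3 _ _ _ _ = o1f3
  inD'ᵒ⇒D' {3} _ _ 1 _ _ (suc (suc (suc (suc _)))) _ _ _ ()
  inD'ᵒ⇒D' {3} _ _ 2 _ _ 0 _ _ _ _ = on (lit _) (lit _)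
  inD'ᵒ⇒D' {3} _ _ 2 _ _ 1 _ _ _ _ = onf1 (lit _) (lit _)
  inD'ᵒ⇒D' {3} _ _ 2 _ _ 2 _ _ _ _ = onf2 (lit _) (lit _)
  inD'ᵒ⇒D' {3} _ _ 2 _ _ (suc (suc (suc _))) _ _ _ ()
  inD'ᵒ⇒D' {3} _ _ 3 _ _ 0 _ _ _ _ = on (lit _) (lit _)
  inD'ᵒ⇒D' {3} _ _ 3 _ _ 1 _ _ _ _ = onf1 (lit _) (lit _)
  inD'ᵒ⇒D' {3} _ _ 3 _ _ 2 _ _ _ _ = onf2 (lit _) (lit _)
  inD'ᵒ⇒D' {3} _ _ 3 _ _ (suc (suc (suc _))) _ _ _ ()
  inD'ᵒ⇒D' {3} _ _ 4 _ _ 0 _ _ _ _ = on (lit _) (lit _)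
  inD'ᵒ⇒D' {3} _ _ 4 _ _ 1 _ _ _ _ = onf1 (lit _) (lit _)
  inD'ᵒ⇒D' {3} _ _ 4 _ _ (suc (suc _)) _ _ _ ()
  inD'ᵒ⇒D' {3} _ _ 5 _ _ 0 _ _ _ _ = on (lit _) (lit _)
  inD'ᵒ⇒D' {3} _ _ 5 _ _ 1 _ _ _ _ = onf1 (lit _) (lit _)
  inD'ᵒ⇒D' {3} _ _ 5 _ _ (suc (suc _)) _ _ _ ()
  inD'ᵒ⇒D' {3} _ _ 6 ε t 0 _ _ _ p = o6 (nonzero ε t (∨-false-elim (proj₁ (split p))))
  inD'ᵒ⇒D' {3} _ _ 6 _ _ 1 _ _ _ ()
  inD'ᵒ⇒D' {3} _ _ 6 _ _ (suc (suc _)) _ _ _ ()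
  inD'ᵒ⇒D' {3} _ _ 7 ε t 0 _ _ t<8 p = o7 (Equivalence.from (kronecker⇔ ε t t<8) (∨-false-elim (proj₁ (split p))))
  inD'ᵒ⇒D' {3} _ _ 7 _ _ 1 _ _ _ ()
  inD'ᵒ⇒D' {3} _ _ 7 _ _ (suc (suc _)) _ _ _ ()
  inD'ᵒ⇒D' {3} _ _ (suc (suc (suc (suc (suc (suc (suc (suc _)))))))) _ _ _ _ _ _ ()
  inD'ᵒ⇒D' {suc (suc (suc (suc _)))} _ (s≤s (s≤s (s≤s ())))
  inD'ᵒ⇒D' {0} () _

  inD'ᵉ⇒D' : ∀ {k} → 1 ≤ k → k ≤ 3 → ∀ b v m δ σ → T (inD'ᵉ k (suc b) v m) → D' k (even2 (sign v) (2 * suc b)) (scale4Part m δ σ)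
  inD'ᵉ⇒D' {1} _ _ 0 true 0 _ _ _ = IIm2
  inD'ᵉ⇒D' {1} _ _ 0 true (suc _) _ _ ()
  inD'ᵉ⇒D' {1} _ _ 0 false _ _ _ ()
  inD'ᵉ⇒D' {1} _ _ (suc _) _ _ _ _ ()
  inD'ᵉ⇒D' {2} _ _ 0 v 0 _ _ _ = II2
  inD'ᵉ⇒D' {2} _ _ 0 v 1 _ _ _ = II2f1
  inD'ᵉ⇒D' {2} _ _ 0 v (suc (suc _)) _ _ ()
  inD'ᵉ⇒D' {2} _ _ 1 true 0 _ _ _ = IIm4
  inD'ᵉ⇒D' {2} _ _ 1 true (suc _) _ _ ()
  inD'ᵉ⇒D' {2} _ _ 1 false _ _ _ ()
  inD'ᵉ⇒D' {2} _ _ (suc (suc _)) _ _ _ _ ()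
  inD'ᵉ⇒D' {3} _ _ 0 v 0 _ _ _ = II2
  inD'ᵉ⇒D' {3} _ _ 0 v 1 _ _ _ = II2f1
  inD'ᵉ⇒D' {3} _ _ 0 v 2 _ _ _ = II2f2
  inD'ᵉ⇒D' {3} _ _ 0 v (suc (suc (suc _))) _ _ ()
  inD'ᵉ⇒D' {3} _ _ 1 v 0 _ _ _ = II4
  inD'ᵉ⇒D' {3} _ _ 1 v 1 _ _ _ = II4f1
  inD'ᵉ⇒D' {3} _ _ 1 v (suc (suc _)) _ _ ()
  inD'ᵉ⇒D' {3} _ _ 2 true 0 _ _ _ = IIm6
  inD'ᵉ⇒D' {3} _ _ 2 true (suc _) _ _ ()
  inD'ᵉ⇒D' {3} _ _ 2 false _ _ _ ()
  inD'ᵉ⇒D' {3} _ _ (suc (suc (suc _))) _ _ _ _ ()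
  inD'ᵉ⇒D' {suc (suc (suc (suc _)))} _ (s≤s (s≤s (s≤s ())))
  inD'ᵉ⇒D' {0} () _

  rank₄-scale4Part : ∀ m δ σ → rank₄ (scale4Part m δ σ) ≡ m
  rank₄-scale4Part zero    _ _ = refl
  rank₄-scale4Part (suc m) _ _ = refl

  inD-oddPart : ∀ k n ε t m δ σ → inD k (oddPart n ε t) (scale4Part m δ σ) ≡ inD'ᵒ k n (invariant ε t) m
  inD-oddPart k (suc n) ε t m δ σ = cong (inD'ᵒ k (suc n) (invariant ε t)) (rank₄-scale4Part m δ σ)
  inD-oddPart k zero    ε t m δ σ = trans (cong (inD'ᵒ k 0 0) (rank₄-scale4Part m δ σ)) (no-invariant k)
    where
    no-invariant : ∀ k → inD'ᵒ k 0 0 m ≡ inD'ᵒ k 0 (invariant ε t) m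
    no-invariant 1 = refl
    no-invariant 2 = refl
    no-invariant 3 = refl
    no-invariant 0 = refl
    no-invariant (suc (suc (suc (suc _)))) = refl

  odd-membership : ∀ {k} → 1 ≤ k → k ≤ 3 → ∀ ms m δ σ →
    D' k (oddPart (length ms) (oddSign ms) (oddity ms)) (scale4Part m δ σ) ⇔
    T (inD'ᵒ k (length (map residue ms)) (signedOddity (map residue ms)) m)
  odd-membership {k} 1≤k k≤3 ms m δ σ = mk⇔
    (λ d → subst T (trans (inD-oddPart k n ε t m δ σ) same-invariant) (D'⇒inD k d (reduced n)))
    (λ p → inD'ᵒ⇒D' 1≤k k≤3 n ε t m δ σ (oddity<8 ms) (subst T (sym same-invariant) p))
    where
    n = length ms
    ε = oddSign ms
    t = oddity ms
    same-invariant : inD'ᵒ k n (invariant ε t) m ≡ inD'ᵒ k (length (map residue ms)) (signedOddity (map residue ms)) m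
    same-invariant = cong₂ (λ n e → inD'ᵒ k n e m) (sym (length-map residue ms)) (invariant-oddity ms)
    reduced : ∀ n → OddityReduced (oddPart n ε t)
    reduced zero    = tt
    reduced (suc _) = oddity<8 ms

  even-membership : ∀ {k} → 1 ≤ k → k ≤ 3 → ∀ e es m δ σ → let es⁺ = e ∷ es in
    D' k (even2 (sign (minusSign es⁺)) (2 * length es⁺)) (scale4Part m δ σ) ⇔ T (inD'ᵉ k (length es⁺) (minusSign es⁺) m)
  even-membership {k} 1≤k k≤3 e es m δ σ = mk⇔
    (λ d → subst T (same-membership (length es) (minusSign (e ∷ es))) (D'⇒inD k d _))
    (inD'ᵉ⇒D' 1≤k k≤3 (length es) (minusSign (e ∷ es)) m δ σ)
    where
    isMinus-sign : ∀ v → isMinus (sign v) ≡ v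
    isMinus-sign true  = refl
    isMinus-sign false = refl
    same-membership : ∀ b v → inD k (even2 (sign v) (2 * suc b)) (scale4Part m δ σ) ≡ inD'ᵉ k (suc b) v m
    same-membership b v =
      trans (cong (λ x → inD'ᵉ k x (isMinus (sign v)) (rank₄ (scale4Part m δ σ)))
                  (trans (cong (_/ 2) (ℕ.*-comm 2 (suc b))) (m*n/n≡m (suc b) 2)))
            (cong₂ (inD'ᵉ k (suc b)) (isMinus-sign v) (rank₄-scale4Part m δ σ))


module JordanShape where

  open import Defs
  open Cells using (line; IsNull; nullLine; nullPlane)
  open TwoTorsion using (cells; cellOf; residue)
  open Tables using (residueLine; livePlane; minusSign)
  open Membership using (oddPart; scale4Part; sign)
  open import Data.Bool using (true; false; not)
  open import Data.Nat as ℕ using (ℕ; zero; suc; _<_; _≤_; s≤s; z≤n; _*_)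
  open import Data.Nat.Properties using (<-trans)
  open import Data.List using (List; []; _∷_; map; _++_; length; replicate)
  open import Data.List.Properties using (map-++; ++-identityʳ)
  open import Data.List.Relation.Unary.All as All using (All; []; _∷_)
  open import Data.List.Relation.Unary.All.Properties as Allₚ using (++⁺)
  open import Data.List.Relation.Unary.Linked using (Linked; []; [-]; _∷_)
  open import Data.List.Relation.Unary.Linked.Properties using (Linked⇒All)
  open import Data.List.Relation.Binary.Permutation.Propositional as Perm using (_↭_; ↭-sym)
  import Data.List.Relation.Binary.Permutation.Propositional.Properties as Permₚ
  open import Data.Product using (Σ-syntax; _×_; _,_)
  open import Data.Sign as Sign using (Sign)
  open import Relation.Binary.PropositionalEquality

  cells-++ : ∀ xs ys → cells (xs ++ ys) ≡ cells xs ++ cells ys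
  cells-++ xs ys = map-++ cellOf xs ys

  atoms-split : ∀ D → atoms D ↭ atoms (compsA D) ++ atoms (compsB D)
  atoms-split [] = Perm.refl
  atoms-split (c ∷ D) with inA c
  ... | true  = Perm.trans (Permₚ.++⁺ˡ (compAtoms c) (atoms-split D))
                           (↭-sym (Perm.↭-reflexive (++-assoc (compAtoms c) (atoms (compsA D)) (atoms (compsB D)))))
    where open import Data.List.Properties using (++-assoc)
  ... | false = Perm.trans (Permₚ.++⁺ˡ (compAtoms c) (atoms-split D)) (Permₚ.shifts (compAtoms c) (atoms (compsA D)))

  cells-split : ∀ D → cells (atoms D) ↭ cells (atoms (compsA D)) ++ cells (atoms (compsB D))
  cells-split D = subst (cells (atoms D) ↭_) (cells-++ (atoms (compsA D)) (atoms (compsB D)))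
                        (Permₚ.map⁺ cellOf (atoms-split D))

  -- The components of B have scale at least 8 (odd) or 4 (even): q vanishes on their 2-torsion.
  null-B : ∀ D → All IsNull (cells (atoms (compsB D)))
  null-B [] = []
  null-B (c ∷ D) with inA c in eq
  ... | true  = null-B D
  ... | false = subst (All IsNull) (sym (cells-++ (compAtoms c) (atoms (compsB D)))) (++⁺ (null-component c eq) (null-B D))
    where
    null-component : ∀ c → inA c ≡ false → All IsNull (cells (compAtoms c))
    null-component (oddC (suc (suc j)) ms) _ = nullLines ms
      where nullLines : ∀ ms → All IsNull (cells (compAtoms (oddC (suc (suc j)) ms)))
            nullLines []       = []
            nullLines (_ ∷ ms) = nullLine ∷ nullLines ms
    null-component (evenC (suc j) bs) _ = nullPlanes bs
      where nullPlanes : ∀ bs → All IsNull (cells (compAtoms (evenC (suc j) bs)))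
            nullPlanes []       = []
            nullPlanes (U ∷ bs) = nullPlane ∷ nullPlanes bs
            nullPlanes (V ∷ bs) = nullPlane ∷ nullPlanes bs

  data ScaleTwo : List Comp → Set where
    none : ScaleTwo []
    odd  : ∀ ms → ScaleTwo (oddC 0 ms ∷ [])
    even : ∀ es → ScaleTwo (evenC 0 es ∷ [])

  data ScaleFour : List Comp → Set where
    none : ScaleFour []
    odd  : ∀ ms → ScaleFour (oddC 1 ms ∷ [])

  private
    Below : Comp → Comp → Set
    Below c d = scaleExp c < scaleExp d

    above : ∀ {c cs} → Linked Below (c ∷ cs) → All (Below c) cs
    above [-]      = []
    above {c} (r ∷ l) = Linked⇒All {R = Below} (λ {i} {j} {k} → <-trans {scaleExp i} {scaleExp j} {scaleExp k}) {v = c} r l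

    tail : ∀ {c cs} → Linked Below (c ∷ cs) → Linked Below cs
    tail [-]     = []
    tail (_ ∷ l) = l

    weaken : ∀ {a b cs} → a < b → All (λ d → b < scaleExp d) cs → All (λ d → a < scaleExp d) cs
    weaken a<b = All.map (<-trans a<b)

    no-A-from-8 : ∀ cs → All (λ d → 2 ≤ scaleExp d) cs → compsA cs ≡ []
    no-A-from-8 [] _ = refl
    no-A-from-8 (oddC (suc (suc _)) _ ∷ cs) (_ ∷ a) = no-A-from-8 cs a
    no-A-from-8 (evenC (suc _) _ ∷ cs)      (_ ∷ a) = no-A-from-8 cs a
    no-A-from-8 (oddC zero _ ∷ _)           (() ∷ _)
    no-A-from-8 (oddC (suc zero) _ ∷ _)     (s≤s () ∷ _)
    no-A-from-8 (evenC zero _ ∷ _)          (() ∷ _)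

    A-from-4 : ∀ cs → Linked Below cs → All (λ d → 1 ≤ scaleExp d) cs → Σ[ A₄ ∈ List Comp ] ScaleFour A₄ × compsA cs ≡ A₄
    A-from-4 [] _ _ = [] , none , refl
    A-from-4 (oddC (suc zero) ms ∷ cs) l _ = oddC 1 ms ∷ [] , odd ms , cong (oddC 1 ms ∷_) (no-A-from-8 cs (above l))
    A-from-4 (evenC (suc zero) _ ∷ cs) l _ = [] , none , no-A-from-8 cs (above l)
    A-from-4 (oddC (suc (suc _)) _ ∷ cs) l _ = [] , none , no-A-from-8 cs (weaken (s≤s (s≤s z≤n)) (above l))
    A-from-4 (evenC (suc (suc _)) _ ∷ cs) l _ = [] , none , no-A-from-8 cs (weaken (s≤s (s≤s z≤n)) (above l))
    A-from-4 (oddC zero _ ∷ _)  _ (() ∷ _)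
    A-from-4 (evenC zero _ ∷ _) _ (() ∷ _)

  A-shape : ∀ D → IsJordan D → Σ[ A₂ ∈ List Comp ] Σ[ A₄ ∈ List Comp ] ScaleTwo A₂ × ScaleFour A₄ × compsA D ≡ A₂ ++ A₄
  A-shape [] _ = [] , [] , none , none , refl
  A-shape (oddC zero ms ∷ cs) l with A-from-4 cs (tail l) (above l)
  ... | A₄ , s₄ , e = oddC 0 ms ∷ [] , A₄ , odd ms , s₄ , cong (oddC 0 ms ∷_) e
  A-shape (evenC zero es ∷ cs) l with A-from-4 cs (tail l) (above l)
  ... | A₄ , s₄ , e = evenC 0 es ∷ [] , A₄ , even es , s₄ , cong (evenC 0 es ∷_) e
  A-shape (c@(oddC (suc _) _) ∷ cs) l with A-from-4 (c ∷ cs) l (s≤s z≤n ∷ weaken (s≤s z≤n) (above l))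
  ... | A₄ , s₄ , e = [] , A₄ , none , s₄ , e
  A-shape (c@(evenC (suc _) _) ∷ cs) l with A-from-4 (c ∷ cs) l (s≤s z≤n ∷ weaken (s≤s z≤n) (above l))
  ... | A₄ , s₄ , e = [] , A₄ , none , s₄ , e

  data AView (A : List Comp) : Set where
    oddView  : ∀ ms ms' → part2 A ≡ oddPart (length ms) (oddSign ms) (oddity ms) →
               part4 A ≡ scale4Part (length ms') (oddSign ms') (oddity ms') →
               cells (atoms A) ≡ map residueLine (map residue ms) ++ replicate (length ms') (line 2) → AView A
    evenView : ∀ e es ms' → part2 A ≡ even2 (sign (minusSign (e ∷ es))) (2 * suc (length es)) →
               part4 A ≡ scale4Part (length ms') (oddSign ms') (oddity ms') →
               cells (atoms A) ≡ map livePlane (e ∷ es) ++ replicate (length ms') (line 2) → AView A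

  private
    cells-odd₂ : ∀ ms → cells (compAtoms (oddC 0 ms)) ≡ map residueLine (map residue ms)
    cells-odd₂ []       = refl
    cells-odd₂ (_ ∷ ms) = cong (_ ∷_) (cells-odd₂ ms)

    cells-even₂ : ∀ es → cells (compAtoms (evenC 0 es)) ≡ map livePlane es
    cells-even₂ []       = refl
    cells-even₂ (U ∷ es) = cong (_ ∷_) (cells-even₂ es)
    cells-even₂ (V ∷ es) = cong (_ ∷_) (cells-even₂ es)

    cells-odd₄ : ∀ ms → cells (compAtoms (oddC 1 ms)) ≡ replicate (length ms) (line 2)
    cells-odd₄ []       = refl
    cells-odd₄ (_ ∷ ms) = cong (_ ∷_) (cells-odd₄ ms)

    cells-single : ∀ c → cells (atoms (c ∷ [])) ≡ cells (compAtoms c)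
    cells-single c = cong cells (++-identityʳ (compAtoms c))

    evenSign≡ : ∀ es → evenSign es ≡ sign (minusSign es)
    evenSign≡ []       = refl
    evenSign≡ (U ∷ es) = evenSign≡ es
    evenSign≡ (V ∷ es) = trans (cong (Sign.- Sign.*_) (evenSign≡ es)) (flip (minusSign es))
      where flip : ∀ b → Sign.- Sign.* sign b ≡ sign (not b)
            flip true  = refl
            flip false = refl

    scale4-view : ∀ {A₄} → ScaleFour A₄ → Σ[ ms' ∈ List ℕ ]
      (part4 A₄ ≡ scale4Part (length ms') (oddSign ms') (oddity ms')) × (cells (atoms A₄) ≡ replicate (length ms') (line 2))
    scale4-view none             = [] , refl , refl
    scale4-view (odd [])         = [] , refl , refl
    scale4-view (odd ms@(_ ∷ _)) = ms , refl , trans (cells-single (oddC 1 ms)) (cells-odd₄ ms)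

  view : ∀ {A₂ A₄} → ScaleTwo A₂ → ScaleFour A₄ → AView (A₂ ++ A₄)
  view none s₄ with scale4-view s₄
  view none none    | ms' , e₄ , c₄ = oddView [] ms' refl e₄ c₄
  view none (odd _) | ms' , e₄ , c₄ = oddView [] ms' refl e₄ c₄
  view {A₄ = A₄} (odd ms) s₄ with scale4-view s₄
  ... | ms' , e₄ , c₄ = oddView ms ms' (part2-odd ms) e₄
          (trans (cells-++ (compAtoms (oddC 0 ms)) (atoms A₄)) (cong₂ _++_ (cells-odd₂ ms) c₄))
    where part2-odd : ∀ ms → part2 (oddC 0 ms ∷ A₄) ≡ oddPart (length ms) (oddSign ms) (oddity ms)
          part2-odd []      = refl
          part2-odd (_ ∷ _) = refl
  view (even []) s₄ with scale4-view s₄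
  ... | ms' , e₄ , c₄ = oddView [] ms' refl e₄ c₄
  view {A₄ = A₄} (even (e ∷ es)) s₄ with scale4-view s₄
  ... | ms' , e₄ , c₄ = evenView e es ms' (cong (λ ε → even2 ε (2 * suc (length es))) (evenSign≡ (e ∷ es))) e₄
          (trans (cells-++ (compAtoms (evenC 0 (e ∷ es))) (atoms A₄)) (cong₂ _++_ (cells-even₂ (e ∷ es)) c₄))

  A-view : ∀ D → IsJordan D → AView (compsA D)
  A-view D J with A-shape D J
  ... | _ , _ , s₂ , s₄ , eq = subst AView (sym eq) (view s₂ s₄)


module Classification where

  open import Defs
  open Cells
  open Tables
  open TableFacts
  open TwoTorsion using (cells; residue)
  open Membership using (odd-membership; even-membership)
  open JordanShape using (AView; oddView; evenView)
  open import Data.Nat using (suc; _≤_; _<_; _∸_; z≤n; s≤s)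
  open import Data.List using (List; _∷_; _++_; map; replicate; length)
  open import Data.List.Properties using (++-assoc)
  open import Data.Product using (_×_; _,_; proj₁; proj₂)
  open import Data.Sum using (_⊎_; inj₁; inj₂)
  open import Function using (_∘_)
  open import Function.Bundles using (Equivalence)
  open import Relation.Binary.PropositionalEquality using (_≡_; sym; trans; cong; subst; subst₂)
  open import Relation.Nullary using (¬_)

  private
    k-range : ∀ r → r < 3 → 1 ≤ 3 ∸ r × 3 ∸ r ≤ 3
    k-range 0 _ = s≤s z≤n , s≤s (s≤s (s≤s z≤n))
    k-range 1 _ = s≤s z≤n , s≤s (s≤s z≤n)
    k-range 2 _ = s≤s z≤n , s≤s z≤n
    k-range (suc (suc (suc _))) (s≤s (s≤s (s≤s ())))

    with-nullLines : ∀ {A} scale₂ m r → cells (atoms A) ≡ scale₂ ++ replicate m (line 2) →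
                     cells (atoms A) ++ nullLines r ≡ shape scale₂ m r
    with-nullLines scale₂ m r e = trans (cong (_++ nullLines r) e) (++-assoc scale₂ (replicate m (line 2)) (nullLines r))

  member-anisotropic : ∀ {A} → AView A → ∀ r → r < 3 → D' (3 ∸ r) (part2 A) (part4 A) →
                       ¬ HasIsotropic3 (cells (atoms A) ++ nullLines r)
  member-anisotropic {A} (oddView ms ms' e₂ e₄ eA) r r<3 d =
    membersFreeᵒ-sound {3 ∸ r} {r} (T-ok (membersFreeᵒ-ok (verified r r<3))) (map residue ms) (length ms')
      (Equivalence.to (odd-membership 1≤k k≤3 ms _ _ _) (subst₂ (D' (3 ∸ r)) e₂ e₄ d))
    ∘ subst HasIsotropic3 (with-nullLines {A} (map residueLine (map residue ms)) (length ms') r eA)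
    where open Verified
          1≤k = proj₁ (k-range r r<3)
          k≤3 = proj₂ (k-range r r<3)
  member-anisotropic {A} (evenView e es ms' e₂ e₄ eA) r r<3 d =
    membersFreeᵉ-sound {3 ∸ r} {r} (T-ok (membersFreeᵉ-ok (verified r r<3))) e es (length ms')
      (Equivalence.to (even-membership 1≤k k≤3 e es _ _ _) (subst₂ (D' (3 ∸ r)) e₂ e₄ d))
    ∘ subst HasIsotropic3 (with-nullLines {A} (map livePlane (e ∷ es)) (length ms') r eA)
    where open Verified
          1≤k = proj₁ (k-range r r<3)
          k≤3 = proj₂ (k-range r r<3)

  member-or-isotropic : ∀ {A} → AView A → ∀ r → r < 3 →
                        D' (3 ∸ r) (part2 A) (part4 A) ⊎ HasIsotropic3 (cells (atoms A) ++ nullLines r)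
  member-or-isotropic {A} (oddView ms ms' e₂ e₄ eA) r r<3 with decideᵒ (verified r r<3) (map residue ms) (length ms')
  ... | inj₁ member = inj₁ (subst₂ (D' (3 ∸ r)) (sym e₂) (sym e₄)
                        (Equivalence.from (odd-membership (proj₁ (k-range r r<3)) (proj₂ (k-range r r<3)) ms _ _ _) member))
  ... | inj₂ iso    = inj₂ (subst HasIsotropic3 (sym (with-nullLines {A} (map residueLine (map residue ms)) (length ms') r eA)) iso)
  member-or-isotropic {A} (evenView e es ms' e₂ e₄ eA) r r<3 with decideᵉ (verified r r<3) e es (length ms')
  ... | inj₁ member = inj₁ (subst₂ (D' (3 ∸ r)) (sym e₂) (sym e₄)
                        (Equivalence.from (even-membership (proj₁ (k-range r r<3)) (proj₂ (k-range r r<3)) e es _ _ _) member))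
  ... | inj₂ iso    = inj₂ (subst HasIsotropic3 (sym (with-nullLines {A} (map livePlane (e ∷ es)) (length ms') r eA)) iso)

open import Defs
open Cells
open TableFacts using (replicate-⊆; fromFound)
open TwoTorsion using (cells; isotropicSubgroup⇒; isotropicSubgroup⇐)
open Rank using (dimA; rank≤2⇒dim≤rank; dim≤2⇒rank≡dim)
open JordanShape using (cells-split; null-B; A-view)
open Classification using (member-anisotropic; member-or-isotropic)
open import Data.Nat using (_<_; _≤_; _∸_; _<?_)
open import Data.Nat.Properties using (≤-pred; ≮⇒≥)
open import Data.List using (List; _++_)
open import Data.List.Relation.Binary.Permutation.Propositional using (↭-sym)
open import Data.List.Relation.Binary.Sublist.Propositional using (⊆-refl)
import Data.List.Relation.Binary.Sublist.Propositional.Properties as Sub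
open import Data.Unit using (tt)
open import Data.Product using (_×_; _,_; ∃-syntax)
open import Data.Sum using (inj₁; inj₂)
open import Data.Empty using (⊥-elim)
open import Function using (_∘_)
open import Function.Bundles using (_⇔_; mk⇔; Equivalence)
open import Relation.Nullary using (¬_; yes; no)

isotropic⇔model : ∀ D → HasIsotropicZ2³ D ⇔ HasIsotropic3 (cells (atoms (compsA D)) ++ nullLines (dimA (atoms (compsB D))))
isotropic⇔model D = mk⇔
  (transport (++ᴵ cellsA (flattenᴵ (null-B D)) ∘ᴵ ↭ᴵ (cells-split D)) ∘ isotropicSubgroup⇒ D)
  (isotropicSubgroup⇐ D ∘ transport (↭ᴵ (↭-sym (cells-split D)) ∘ᴵ ++ᴵ cellsA (unflattenᴵ (null-B D))))
  where cellsA = cells (atoms (compsA D))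

more-nullLines : ∀ cs {a b} → a ≤ b → HasIsotropic3 (cs ++ nullLines a) → HasIsotropic3 (cs ++ nullLines b)
more-nullLines cs a≤b = transport (⊆ᴵ (Sub.++⁺ (⊆-refl {x = cs}) (replicate-⊆ (line 0) a≤b)))

three-nullLines : ∀ cs → HasIsotropic3 (cs ++ nullLines 3)
three-nullLines cs = transport (⊆ᴵ (Sub.++⁺ˡ cs ⊆-refl)) (fromFound (nullLines 3) tt)

mainTheorem19 : (D : List Comp) → IsJordan D →
    (¬ HasIsotropicZ2³ D) ⇔
    (∃[ r ] (HasRank (compsB D) r × r < 3 × InD' (3 ∸ r) (compsA D)))
mainTheorem19 D J = mk⇔ classify exclude
  where
  A = compsA D
  B = compsB D
  N = dimA (atoms B)
  view = A-view D J
  model = isotropic⇔model D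
  classify : ¬ HasIsotropicZ2³ D → ∃[ r ] (HasRank B r × r < 3 × InD' (3 ∸ r) A)
  classify anisotropic with N <? 3
  ... | no N≮3 = ⊥-elim (anisotropic (Equivalence.from model
          (more-nullLines (cells (atoms A)) (≮⇒≥ N≮3) (three-nullLines (cells (atoms A))))))
  ... | yes N<3 with member-or-isotropic view N N<3
  ...   | inj₁ member = N , dim≤2⇒rank≡dim B (≤-pred N<3) , N<3 , member
  ...   | inj₂ iso    = ⊥-elim (anisotropic (Equivalence.from model iso))
  exclude : ∃[ r ] (HasRank B r × r < 3 × InD' (3 ∸ r) A) → ¬ HasIsotropicZ2³ D
  exclude (r , rank , r<3 , member) =
    member-anisotropic view r r<3 member
    ∘ more-nullLines (cells (atoms A)) (rank≤2⇒dim≤rank B r rank r<3) ∘ Equivalence.to model
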